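{- Let $p$ be a prime number, $P(n)$ a polynomial with integer coefficients, and let $(C_i)_{1\le i\le r}$, $(D_i)_{1\le i\le s}$, $(E_i)_{1\le i\le t}$, $(F_i)_{1\le i\le t}$ be integer sequences with $C_i>0$, $D_i>0$ for all $i$, $\sum_{i=1}^rC_i=\sum_{i=1}^sD_i$, and $\{C_i:1\le i\le r\}\ne\{D_i:1\le i\le s\}$. Define \[ S(n):=\frac{P(n)}{\prod_{i=1}^t(E_in+F_i)}\cdot\frac{\prod_{i=1}^r(C_in)!}{\prod_{i=1}^s(D_in)!},\qquad n\ge0, \] and suppose that all elements of the sequence $(S(n))_{n\ge0}$ are integers. Then for every positive integer $m$, \[ \lim_{N\to\infty}\frac1N\#\{0\le n<N:\ S(n)\equiv0\pmod m\}=1. \] -}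

module Defs where

open import Data.Nat as ℕ using (ℕ; zero; suc; _!)
open import Data.Integer as ℤ using (ℤ; +_)
open import Data.Fin using (Fin)
open import Data.List using (List; []; _∷_; foldr; tabulate; length; filter; upTo)
open import Data.Integer.Divisibility.Signed using (_∣_; _∣?_)

-- evaluation of an integer polynomial given by its coefficient list
-- (constant term first): eval [a₀, a₁, …] x = a₀ + a₁ x + …
evalPoly : List ℤ → ℤ → ℤ
evalPoly []       x = + 0
evalPoly (a ∷ as) x = a ℤ.+ x ℤ.* evalPoly as x

sumFin : ∀ {k} → (Fin k → ℕ) → ℕ
sumFin f = foldr ℕ._+_ 0 (tabulate f)

prodFinℤ : ∀ {k} → (Fin k → ℤ) → ℤ
prodFinℤ f = foldr ℤ._*_ (+ 1) (tabulate f)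

numer : List ℤ → ∀ {r} → (Fin r → ℕ) → ℕ → ℤ
numer P C n = evalPoly P (+ n) ℤ.* prodFinℤ (λ i → + ((C i ℕ.* n) !))

linProd : ∀ {t} → (Fin t → ℤ) → (Fin t → ℤ) → ℕ → ℤ
linProd E F n = prodFinℤ (λ i → E i ℤ.* + n ℤ.+ F i)

denom : ∀ {t} → (Fin t → ℤ) → (Fin t → ℤ) → ∀ {s} → (Fin s → ℕ) → ℕ → ℤ
denom E F D n = linProd E F n ℤ.* prodFinℤ (λ i → + ((D i ℕ.* n) !))

countDiv : ℕ → (ℕ → ℤ) → ℕ → ℕ
countDiv m S N = length (filter (λ n → + m ∣? S n) (upTo N))

{-# OPTIONS --safe #-}
-- Comparing q-adic valuations at n ≈ qy/z for a large prime q (chosen, via a finite-difference argument,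
-- so that q ∤ P(n)) gives Landau's inequality Σⱼ ⌊Dⱼ y/z⌋ ≤ Σᵢ ⌊Cᵢ y/z⌋ for 0 ≤ y < z.  It is strict at
-- some y₀/z₀, since otherwise the floor sums at 1/c and K/(1 + cK) would show that every c divides
-- equally many Cᵢ and Dⱼ, forcing {Cᵢ} = {Dⱼ}.  For a prime q, Legendre's formula writes the q-adic
-- valuation of ∏(Cᵢn)!/∏(Dⱼn)! as a sum of these floor-sum differences over the levels qˡ, and a level
-- contributes at least 1 whenever a base-q^b digit of n equals the digit w with w/q^b just above y₀/z₀.
-- Almost every n has many such digits, while each linear factor Eᵢn + Fᵢ is divisible by a high power
-- of q only for a sparse set of n; so qᵃ ∣ S(n) for almost all n, and coprime prime powers combine.
module Submission where

open import Defs
open import Data.Nat as ℕ using (ℕ; _≤_; _<_; _∸_)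
open import Data.Nat.Primality using (Prime)

module FiniteSums where

  open import Data.Nat
  open import Data.Nat.Properties
  open import Data.Nat.DivMod
  open import Data.Fin using (Fin; zero; suc)
  open import Data.Product using (_,_)
  open import Function using (_∘_)
  open import Relation.Binary.PropositionalEquality
  open import Relation.Nullary using (¬_; ¬?; Dec; yes; no; contradiction)
  open import Data.List using (length; filter; applyUpTo)
  open import Relation.Unary using (Pred; Decidable)
  open import Algebra.Properties.CommutativeSemigroup +-commutativeSemigroup using (interchange)

  𝟙 : {A : Set} → Dec A → ℕ
  𝟙 (yes _) = 1
  𝟙 (no _)  = 0

  𝟙≤1 : {A : Set} (a? : Dec A) → 𝟙 a? ≤ 1
  𝟙≤1 (yes _) = s≤s z≤n
  𝟙≤1 (no _)  = z≤n

  𝟙-yes : {A : Set} (a? : Dec A) → A → 𝟙 a? ≡ 1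
  𝟙-yes (yes _) _ = refl
  𝟙-yes (no ¬a) a = contradiction a ¬a

  𝟙-no : {A : Set} (a? : Dec A) → ¬ A → 𝟙 a? ≡ 0
  𝟙-no (yes a) ¬a = contradiction a ¬a
  𝟙-no (no _)  _  = refl

  𝟙-mono : {A B : Set} (a? : Dec A) (b? : Dec B) → (A → B) → 𝟙 a? ≤ 𝟙 b?
  𝟙-mono (yes a) (no ¬b) a→b = contradiction (a→b a) ¬b
  𝟙-mono (yes _) (yes _) _   = ≤-refl
  𝟙-mono (no _)  _       _   = z≤n

  𝟙-cong : {A B : Set} (a? : Dec A) (b? : Dec B) → (A → B) → (B → A) → 𝟙 a? ≡ 𝟙 b?
  𝟙-cong a? b? a→b b→a = ≤-antisym (𝟙-mono a? b? a→b) (𝟙-mono b? a? b→a)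

  sum< : (ℕ → ℕ) → ℕ → ℕ
  sum< f zero    = 0
  sum< f (suc N) = f 0 + sum< (f ∘ suc) N

  syntax sum< (λ n → e) N = ∑[ n < N ] e

  sum<-cong-< : ∀ {f g} N → (∀ n → n < N → f n ≡ g n) → sum< f N ≡ sum< g N
  sum<-cong-< zero    _  = refl
  sum<-cong-< (suc N) eq = cong₂ _+_ (eq 0 z<s) (sum<-cong-< N (λ n n<N → eq (suc n) (s<s n<N)))

  sum<-cong : ∀ {f g} → (∀ n → f n ≡ g n) → ∀ N → sum< f N ≡ sum< g N
  sum<-cong eq N = sum<-cong-< N (λ n _ → eq n)

  sum<-mono : ∀ {f g} → (∀ n → f n ≤ g n) → ∀ N → sum< f N ≤ sum< g N
  sum<-mono le zero    = z≤n
  sum<-mono le (suc N) = +-mono-≤ (le 0) (sum<-mono (le ∘ suc) N)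

  sum<-+ : ∀ f g N → ∑[ n < N ] (f n + g n) ≡ sum< f N + sum< g N
  sum<-+ f g zero    = refl
  sum<-+ f g (suc N) = trans (cong (f 0 + g 0 +_) (sum<-+ (f ∘ suc) (g ∘ suc) N))
                             (interchange (f 0) (g 0) _ _)

  sum<-*ˡ : ∀ c f N → ∑[ n < N ] (c * f n) ≡ c * sum< f N
  sum<-*ˡ c f zero    = sym (*-zeroʳ c)
  sum<-*ˡ c f (suc N) = trans (cong (c * f 0 +_) (sum<-*ˡ c (f ∘ suc) N)) (sym (*-distribˡ-+ c _ _))

  sum<-const : ∀ c N → ∑[ n < N ] c ≡ N * c
  sum<-const c zero    = refl
  sum<-const c (suc N) = cong (c +_) (sum<-const c N)

  sum<-≡0 : ∀ {f} N → (∀ n → n < N → f n ≡ 0) → sum< f N ≡ 0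
  sum<-≡0 N zero-below = trans (sum<-cong-< N zero-below) (trans (sum<-const 0 N) (*-zeroʳ N))

  sum<-select : ∀ (g : ℕ → ℕ) {x} B → x < B → ∑[ e < B ] (g e * 𝟙 (x ≟ e)) ≡ g x
  sum<-select g {zero}  (suc B) _ = begin
    g 0 * 1 + ∑[ e < B ] (g (suc e) * 0)  ≡⟨ cong₂ _+_ (*-identityʳ (g 0)) (sum<-≡0 B (λ e _ → *-zeroʳ (g (suc e)))) ⟩
    g 0 + 0                               ≡⟨ +-identityʳ (g 0) ⟩
    g 0                                   ∎
    where open ≡-Reasoning
  sum<-select g {suc x} (suc B) (s<s x<B) = begin
    g 0 * 0 + ∑[ e < B ] (g (suc e) * 𝟙 (suc x ≟ suc e))  ≡⟨ cong₂ _+_ (*-zeroʳ (g 0)) (sum<-cong shift B) ⟩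
    0 + ∑[ e < B ] (g (suc e) * 𝟙 (x ≟ e))                ≡⟨ sum<-select (g ∘ suc) B x<B ⟩
    g (suc x)                                             ∎
    where
    open ≡-Reasoning
    shift : ∀ e → g (suc e) * 𝟙 (suc x ≟ suc e) ≡ g (suc e) * 𝟙 (x ≟ e)
    shift e = cong (g (suc e) *_) (𝟙-cong (suc x ≟ suc e) (x ≟ e) suc-injective (cong suc))

  sum<-≤N : ∀ {f} → (∀ n → f n ≤ 1) → ∀ N → sum< f N ≤ N
  sum<-≤N ≤1 N = ≤-trans (sum<-mono ≤1 N) (≤-reflexive (trans (sum<-const 1 N) (*-identityʳ N)))

  sum<-++ : ∀ f a b → sum< f (a + b) ≡ sum< f a + ∑[ n < b ] f (a + n)
  sum<-++ f zero    b = refl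
  sum<-++ f (suc a) b = trans (cong (f 0 +_) (sum<-++ (f ∘ suc) a b)) (sym (+-assoc (f 0) _ _))

  sum<-monoʳ : ∀ f {N N′} → N ≤ N′ → sum< f N ≤ sum< f N′
  sum<-monoʳ f {N} N≤N′ with m≤n⇒∃[o]m+o≡n N≤N′
  ... | o , refl = ≤-trans (m≤m+n _ _) (≤-reflexive (sym (sum<-++ f N o)))

  sum<-blocks : ∀ Q f X → sum< f (Q * X) ≡ ∑[ x < X ] ∑[ d < Q ] f (Q * x + d)
  sum<-blocks Q f zero    = cong (sum< f) (*-zeroʳ Q)
  sum<-blocks Q f (suc X) = begin
    sum< f (Q * suc X)                        ≡⟨ cong (sum< f) (*-suc Q X) ⟩
    sum< f (Q + Q * X)                        ≡⟨ sum<-++ f Q (Q * X) ⟩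
    sum< f Q + ∑[ n < Q * X ] f (Q + n)       ≡⟨ cong₂ _+_ (sum<-cong (λ d → cong f (first-block d)) Q)
                                                           (sum<-blocks Q (f ∘ (Q +_)) X) ⟩
    ∑[ d < Q ] f (Q * 0 + d) + ∑[ x < X ] ∑[ d < Q ] f (Q + (Q * x + d))
                                              ≡⟨ cong (_ +_) (sum<-cong (λ x → sum<-cong (λ d → cong f (later-block x d)) Q) X) ⟩
    ∑[ x < suc X ] ∑[ d < Q ] f (Q * x + d)   ∎
    where
    open ≡-Reasoning
    first-block : ∀ d → d ≡ Q * 0 + d
    first-block d = cong (_+ d) (sym (*-zeroʳ Q))
    later-block : ∀ x d → Q + (Q * x + d) ≡ Q * suc x + d
    later-block x d = trans (sym (+-assoc Q _ d)) (cong (_+ d) (sym (*-suc Q x)))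

  sum<-periodic : ∀ f T → (∀ n → f (T + n) ≡ f n) → ∀ c → sum< f (c * T) ≡ c * sum< f T
  sum<-periodic f T periodic zero    = refl
  sum<-periodic f T periodic (suc c) = begin
    sum< f (T + c * T)                   ≡⟨ sum<-++ f T (c * T) ⟩
    sum< f T + ∑[ n < c * T ] f (T + n)  ≡⟨ cong (sum< f T +_) (sum<-cong periodic (c * T)) ⟩
    sum< f T + sum< f (c * T)            ≡⟨ cong (sum< f T +_) (sum<-periodic f T periodic c) ⟩
    sum< f T + c * sum< f T              ∎
    where open ≡-Reasoning

  N≤[1+N/W]*W : ∀ N W .{{_ : NonZero W}} → N ≤ suc (N / W) * W
  N≤[1+N/W]*W N W = begin
    N                  ≡⟨ m≡m%n+[m/n]*n N W ⟩
    N % W + N / W * W  ≤⟨ +-monoˡ-≤ _ (m%n≤n N W) ⟩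
    suc (N / W) * W    ∎
    where open ≤-Reasoning

  sum<-periodic-≤ : ∀ f T .{{_ : NonZero T}} → (∀ n → f (T + n) ≡ f n) →
                    ∀ N → sum< f N ≤ suc (N / T) * sum< f T
  sum<-periodic-≤ f T periodic N = begin
    sum< f N                    ≤⟨ sum<-monoʳ f (N≤[1+N/W]*W N T) ⟩
    sum< f (suc (N / T) * T)    ≡⟨ sum<-periodic f T periodic (suc (N / T)) ⟩
    suc (N / T) * sum< f T      ∎
    where open ≤-Reasoning

  sumFin-cong : ∀ {k} {f g : Fin k → ℕ} → (∀ i → f i ≡ g i) → sumFin f ≡ sumFin g
  sumFin-cong {zero}  eq = refl
  sumFin-cong {suc k} eq = cong₂ _+_ (eq zero) (sumFin-cong (eq ∘ suc))

  sumFin-mono : ∀ {k} {f g : Fin k → ℕ} → (∀ i → f i ≤ g i) → sumFin f ≤ sumFin g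
  sumFin-mono {zero}  le = z≤n
  sumFin-mono {suc k} le = +-mono-≤ (le zero) (sumFin-mono (le ∘ suc))

  sumFin-+ : ∀ {k} (f g : Fin k → ℕ) → sumFin (λ i → f i + g i) ≡ sumFin f + sumFin g
  sumFin-+ {zero}  f g = refl
  sumFin-+ {suc k} f g = trans (cong (f zero + g zero +_) (sumFin-+ (f ∘ suc) (g ∘ suc)))
                               (interchange (f zero) (g zero) _ _)

  sumFin-*ˡ : ∀ {k} c (f : Fin k → ℕ) → sumFin (λ i → c * f i) ≡ c * sumFin f
  sumFin-*ˡ {zero}  c f = sym (*-zeroʳ c)
  sumFin-*ˡ {suc k} c f = trans (cong (c * f zero +_) (sumFin-*ˡ c (f ∘ suc))) (sym (*-distribˡ-+ c _ _))

  sumFin-const : ∀ {k} c → sumFin {k} (λ _ → c) ≡ k * c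
  sumFin-const {zero}  c = refl
  sumFin-const {suc k} c = cong (c +_) (sumFin-const {k} c)

  f≤sumFin : ∀ {k} (f : Fin k → ℕ) i → f i ≤ sumFin f
  f≤sumFin f zero    = m≤m+n _ _
  f≤sumFin f (suc i) = ≤-trans (f≤sumFin (f ∘ suc) i) (m≤n+m _ (f zero))

  sum<-sumFin : ∀ {k} (f : Fin k → ℕ → ℕ) N → ∑[ n < N ] sumFin (λ i → f i n) ≡ sumFin (λ i → sum< (f i) N)
  sum<-sumFin {zero}  f N = sum<-≡0 N (λ _ _ → refl)
  sum<-sumFin {suc k} f N = trans (sum<-+ (f zero) _ N) (cong (sum< (f zero) N +_) (sum<-sumFin (f ∘ suc) N))

  term≤sum< : ∀ f {l} L → l < L → f l ≤ sum< f L
  term≤sum< f {zero}  (suc L) _         = m≤m+n (f 0) _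
  term≤sum< f {suc l} (suc L) (s<s l<L) = ≤-trans (term≤sum< (f ∘ suc) L l<L) (m≤n+m _ (f 0))

  length-filter+rejected : ∀ {P : Pred ℕ _} (P? : Decidable P) f N →
    length (filter P? (applyUpTo f N)) + ∑[ n < N ] 𝟙 (¬? (P? (f n))) ≡ N
  length-filter+rejected P? f zero    = refl
  length-filter+rejected P? f (suc N) with P? (f 0)
  ... | yes _ = cong suc (length-filter+rejected P? (f ∘ suc) N)
  ... | no  _ = trans (+-suc _ _) (cong suc (length-filter+rejected P? (f ∘ suc) N))

module Density where

  open import Data.Nat
  open import Data.Nat.Properties
  open import Data.Nat.DivMod
  open import Data.Nat.Tactic.RingSolver using (solve-∀)
  open import Data.Fin using (Fin; zero; suc)
  open import Function using (_∘_)
  open import Relation.Binary.PropositionalEquality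
  open import Relation.Nullary using (yes; no; contradiction)
  open import Relation.Unary using (Pred; Decidable)
  open FiniteSums

  Separated : ℕ → Pred ℕ _ → Set
  Separated W P = ∀ {n n′} → n < n′ → P n → P n′ → W + n ≤ n′

  module _ {W : ℕ} where

    separated-shift : ∀ {P} a → Separated W P → Separated W (λ n → P (a + n))
    separated-shift a sep {n} {n′} n<n′ Pn Pn′ =
      +-cancelˡ-≤ a _ _ (subst (_≤ a + n′) (swap W a n) (sep (+-monoʳ-< a n<n′) Pn Pn′))
      where
      swap : ∀ W a n → W + (a + n) ≡ a + (W + n)
      swap = solve-∀

    separated-window : ∀ {P} (P? : Decidable P) → Separated W P → ∀ L → L ≤ W → ∑[ n < L ] 𝟙 (P? n) ≤ 1
    separated-window P? sep zero    _   = z≤n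
    separated-window P? sep (suc L) L<W with P? 0
    ... | yes P0 = ≤-reflexive (cong suc (sum<-≡0 L absent))
      where
      absent : ∀ n → n < L → 𝟙 (P? (suc n)) ≡ 0
      absent n n<L with P? (suc n)
      ... | yes Pn = contradiction (sep z<s P0 Pn) (<⇒≱ (subst (suc n <_) (sym (+-identityʳ W)) (<-≤-trans (s<s n<L) L<W)))
      ... | no _   = refl
    ... | no _   = separated-window (P? ∘ suc) (separated-shift 1 sep) L (≤-trans (n≤1+n L) L<W)

    separated-blocks : ∀ {P} (P? : Decidable P) → Separated W P → ∀ c → ∑[ n < c * W ] 𝟙 (P? n) ≤ c
    separated-blocks P? sep zero    = z≤n
    separated-blocks P? sep (suc c) = begin
      ∑[ n < W + c * W ] 𝟙 (P? n)                          ≡⟨ sum<-++ _ W (c * W) ⟩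
      ∑[ n < W ] 𝟙 (P? n) + ∑[ n < c * W ] 𝟙 (P? (W + n))  ≤⟨ +-mono-≤ (separated-window P? sep W ≤-refl)
                                                                (separated-blocks (P? ∘ (W +_)) (separated-shift W sep) c) ⟩
      suc c                                                ∎
      where open ≤-Reasoning

  separated-count : ∀ W .{{_ : NonZero W}} {P} (P? : Decidable P) → Separated W P →
                    ∀ N → ∑[ n < N ] 𝟙 (P? n) ≤ suc (N / W)
  separated-count W P? sep N =
    ≤-trans (sum<-monoʳ _ (N≤[1+N/W]*W N W)) (separated-blocks P? sep (suc (N / W)))

  record Sparse (k : ℕ) (f : ℕ → ℕ) : Set where
    constructor sparse
    field
      threshold : ℕ
      bound     : ∀ N → threshold ≤ N → k * sum< f N ≤ N

  DensityZero : (ℕ → ℕ) → Set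
  DensityZero f = ∀ k → Sparse k f

  sparse-≡0 : ∀ k {f} → (∀ n → f n ≡ 0) → Sparse k f
  sparse-≡0 k f≡0 = sparse 0 λ N _ → ≤-trans (≤-reflexive (trans (cong (k *_) (sum<-≡0 N (λ n _ → f≡0 n))) (*-zeroʳ k))) z≤n

  sparse-mono : ∀ {k f g} → (∀ n → f n ≤ g n) → Sparse k g → Sparse k f
  sparse-mono {k} f≤g (sparse N₀ bound) = sparse N₀ λ N N₀≤N → ≤-trans (*-monoʳ-≤ k (sum<-mono f≤g N)) (bound N N₀≤N)

  sparse-+ : ∀ k {f g} → Sparse (2 * k) f → Sparse (2 * k) g → Sparse k (λ n → f n + g n)
  sparse-+ k {f} {g} (sparse N₁ sparse-f) (sparse N₂ sparse-g) = sparse (N₁ + N₂) λ N N₁+N₂≤N → *-cancelˡ-≤ 2 (begin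
    2 * (k * ∑[ n < N ] (f n + g n))              ≡⟨ cong (λ x → 2 * (k * x)) (sum<-+ f g N) ⟩
    2 * (k * (sum< f N + sum< g N))               ≡⟨ distrib k (sum< f N) (sum< g N) ⟩
    2 * k * sum< f N + 2 * k * sum< g N           ≤⟨ +-mono-≤ (sparse-f N (≤-trans (m≤m+n N₁ N₂) N₁+N₂≤N))
                                                              (sparse-g N (≤-trans (m≤n+m N₂ N₁) N₁+N₂≤N)) ⟩
    N + N                                         ≡⟨ cong (N +_) (+-identityʳ N) ⟨
    2 * N                                         ∎)
    where
    open ≤-Reasoning
    distrib : ∀ k x y → 2 * (k * (x + y)) ≡ 2 * k * x + 2 * k * y
    distrib = solve-∀

  sparse-antitone : ∀ {k k′ f} → k ≤ k′ → Sparse k′ f → Sparse k f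
  sparse-antitone {f = f} k≤k′ (sparse N₀ bound) = sparse N₀ λ N N₀≤N → ≤-trans (*-monoˡ-≤ (sum< f N) k≤k′) (bound N N₀≤N)

  sparse-sumFin : ∀ {t} k (f : Fin t → ℕ → ℕ) → (∀ i → Sparse (2 ^ t * k) (f i)) → Sparse k (λ n → sumFin (λ i → f i n))
  sparse-sumFin {zero}  k f _      = sparse-≡0 k (λ _ → refl)
  sparse-sumFin {suc t} k f each = sparse-+ k
    (sparse-antitone (*-monoˡ-≤ k (*-monoʳ-≤ 2 (m^n>0 2 t))) (each zero))
    (sparse-sumFin (2 * k) (f ∘ suc) (λ i → subst (λ k′ → Sparse k′ (f (suc i))) (reassoc (2 ^ t) k) (each (suc i))))
    where
    reassoc : ∀ p k → 2 * p * k ≡ p * (2 * k)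
    reassoc = solve-∀

  sparse-periodic : ∀ k f T .{{_ : NonZero T}} → (∀ n → f (T + n) ≡ f n) → 2 * k * sum< f T ≤ T → Sparse k f
  sparse-periodic k f T periodic 2k*ΣT≤T = sparse T λ N T≤N → *-cancelˡ-≤ 2 (begin
    2 * (k * sum< f N)                   ≡⟨ *-assoc 2 k _ ⟨
    2 * k * sum< f N                     ≤⟨ *-monoʳ-≤ (2 * k) (sum<-periodic-≤ f T periodic N) ⟩
    2 * k * (suc (N / T) * sum< f T)     ≡⟨ swap (2 * k) (suc (N / T)) (sum< f T) ⟩
    suc (N / T) * (2 * k * sum< f T)     ≤⟨ *-monoʳ-≤ (suc (N / T)) 2k*ΣT≤T ⟩
    T + N / T * T                        ≤⟨ +-mono-≤ T≤N (m/n*n≤m N T) ⟩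
    N + N                                ≡⟨ cong (N +_) (+-identityʳ N) ⟨
    2 * N                                ∎)
    where
    open ≤-Reasoning
    swap : ∀ a b c → a * (b * c) ≡ b * (a * c)
    swap = solve-∀

  sparse-separated : ∀ k W .{{_ : NonZero W}} {P} (P? : Decidable P) → 2 * k ≤ W → Separated W P →
                     Sparse k (λ n → 𝟙 (P? n))
  sparse-separated k W P? 2k≤W separated = sparse (2 * k) λ N 2k≤N → *-cancelˡ-≤ 2 (begin
    2 * (k * ∑[ n < N ] 𝟙 (P? n))        ≡⟨ *-assoc 2 k _ ⟨
    2 * k * ∑[ n < N ] 𝟙 (P? n)          ≤⟨ *-monoʳ-≤ (2 * k) (separated-count W P? separated N) ⟩
    2 * k * suc (N / W)                  ≡⟨ *-suc (2 * k) (N / W) ⟩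
    2 * k + 2 * k * (N / W)              ≤⟨ +-mono-≤ 2k≤N (*-monoˡ-≤ (N / W) 2k≤W) ⟩
    N + W * (N / W)                      ≤⟨ +-monoʳ-≤ N (≤-trans (≤-reflexive (*-comm W (N / W))) (m/n*n≤m N W)) ⟩
    N + N                                ≡⟨ cong (N +_) (+-identityʳ N) ⟨
    2 * N                                ∎)
    where open ≤-Reasoning

module PrimeValuation where

  open import Data.Nat
  open import Data.Nat.Properties
  open import Data.Nat.Divisibility
  open import Data.Nat.Primality
  open import Data.Nat.Primality.Factorisation using (factorise)
  open import Data.Nat.ListAction using (product)
  open import Data.List.Relation.Unary.All using (_∷_)
  open import Data.Nat.DivMod using (_/_; _%_)
  open import Data.Nat.Induction using (<-rec)
  open import Data.Nat.Tactic.RingSolver using (solve-∀)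
  open import Data.Fin using (Fin; zero; suc)
  open import Data.List using ([]; _∷_; foldr; tabulate)
  open import Data.Integer as ℤ using (ℤ; ∣_∣)
  import Data.Integer.Properties as ℤ
  open import Data.Product using (Σ; _×_; _,_; proj₁; proj₂)
  open import Data.Sum using (inj₁; inj₂)
  open import Function using (_∘_)
  open import Relation.Binary.PropositionalEquality
  open import Relation.Nullary using (¬_; yes; no; contradiction)
  open FiniteSums using (sumFin-mono)

  prodFin : ∀ {k} → (Fin k → ℕ) → ℕ
  prodFin f = foldr _*_ 1 (tabulate f)

  ∣prodFinℤ∣ : ∀ {k} (f : Fin k → ℤ) → ∣ prodFinℤ f ∣ ≡ prodFin (∣_∣ ∘ f)
  ∣prodFinℤ∣ {zero}  f = refl
  ∣prodFinℤ∣ {suc k} f = trans (ℤ.abs-* (f zero) _) (cong (∣ f zero ∣ *_) (∣prodFinℤ∣ (f ∘ suc)))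

  prodFin≢0 : ∀ {k} (f : Fin k → ℕ) → (∀ i → f i ≢ 0) → prodFin f ≢ 0
  prodFin≢0 {zero}  f f≢0 ()
  prodFin≢0 {suc k} f f≢0 eq with m*n≡0⇒m≡0∨n≡0 (f zero) eq
  ... | inj₁ f0≡0 = f≢0 zero f0≡0
  ... | inj₂ rest≡0 = prodFin≢0 (f ∘ suc) (f≢0 ∘ suc) rest≡0

  prodFin≢0⇒f≢0 : ∀ {k} (f : Fin k → ℕ) → prodFin f ≢ 0 → ∀ i → f i ≢ 0
  prodFin≢0⇒f≢0 f prod≢0 zero    f0≡0 = prod≢0 (cong (_* prodFin (f ∘ suc)) f0≡0)
  prodFin≢0⇒f≢0 f prod≢0 (suc i) =
    prodFin≢0⇒f≢0 (f ∘ suc) (λ rest≡0 → prod≢0 (trans (cong (f zero *_) rest≡0) (*-zeroʳ (f zero)))) i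

  module Valuation (q : ℕ) (q-prime : Prime q) where

    instance
      q≢0 : NonZero q
      q≢0 = prime⇒nonZero q-prime

    infixl 7 _/q^_
    _/q^_ : ℕ → ℕ → ℕ
    N /q^ j = _/_ N (q ^ j) {{m^n≢0 q j}}

    infixl 7 _%q^_
    _%q^_ : ℕ → ℕ → ℕ
    N %q^ j = _%_ N (q ^ j) {{m^n≢0 q j}}

    1<q : 1 < q
    1<q = nonTrivial⇒n>1 q {{prime⇒nonTrivial q-prime}}

    n<q^n : ∀ n → n < q ^ n
    n<q^n zero    = z<s
    n<q^n (suc n) = ≤-<-trans (n<q^n n) (^-monoʳ-< q 1<q (n<1+n n))

    q∤1 : ¬ q ∣ 1
    q∤1 q∣1 = <⇒≢ 1<q (sym (∣1⇒≡1 q∣1))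

    q∤* : ∀ {u v} → ¬ q ∣ u → ¬ q ∣ v → ¬ q ∣ u * v
    q∤* {u} {v} q∤u q∤v q∣uv with euclidsLemma u v q-prime q∣uv
    ... | inj₁ q∣u = q∤u q∣u
    ... | inj₂ q∣v = q∤v q∣v

    q^-∣-mono : ∀ {i j} → i ≤ j → q ^ i ∣ q ^ j
    q^-∣-mono {i} i≤j with m≤n⇒∃[o]m+o≡n i≤j
    ... | o , refl = divides (q ^ o) (trans (^-distribˡ-+-* q i o) (*-comm (q ^ i) (q ^ o)))

    q^e∣u*x⇒q^e∣x : ∀ e {u x} → ¬ q ∣ u → q ^ e ∣ u * x → q ^ e ∣ x
    q^e∣u*x⇒q^e∣x zero    _   _ = 1∣ _
    q^e∣u*x⇒q^e∣x (suc e) {u} {x} q∤u q^[1+e]∣ux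
      with euclidsLemma u x q-prime (∣-trans (n∣m*n (q ^ e)) (subst (_∣ u * x) (*-comm q (q ^ e)) q^[1+e]∣ux))
    ... | inj₁ q∣u = contradiction q∣u q∤u
    ... | inj₂ (divides x′ refl) =
      subst (q * q ^ e ∣_) (*-comm q x′) (*-monoʳ-∣ q (q^e∣u*x⇒q^e∣x e q∤u (*-cancelˡ-∣ q q*q^e∣q*ux′)))
      where
      regroup : ∀ u x′ q → u * (x′ * q) ≡ q * (u * x′)
      regroup = solve-∀
      q*q^e∣q*ux′ : q * q ^ e ∣ q * (u * x′)
      q*q^e∣q*ux′ = subst (q * q ^ e ∣_) (regroup u x′ q) q^[1+e]∣ux

    record HasValuation (x e : ℕ) : Set where
      constructor factor
      field
        unit       : ℕ
        x≡q^e*unit : x ≡ q ^ e * unit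
        q∤unit     : ¬ q ∣ unit

    valuation-exists : ∀ x → x ≢ 0 → Σ ℕ (HasValuation x)
    valuation-exists = <-rec _ go
      where
      go : ∀ x → (∀ {y} → y < x → y ≢ 0 → Σ ℕ (HasValuation y)) → x ≢ 0 → Σ ℕ (HasValuation x)
      go x rec x≢0 with q ∣? x
      ... | no q∤x = 0 , factor x (sym (*-identityˡ x)) q∤x
      ... | yes (divides y refl) with rec y<y*q y≢0
        where
        y≢0 : y ≢ 0
        y≢0 refl = x≢0 refl
        y<y*q : y < y * q
        y<y*q = subst (_< y * q) (*-identityʳ y) (*-monoʳ-< y {{≢-nonZero y≢0}} 1<q)
      ... | e , factor u refl q∤u = suc e , factor u (regroup (q ^ e) u q) q∤u
        where
        regroup : ∀ a u q → a * u * q ≡ q * a * u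
        regroup = solve-∀

    q^v∣x : ∀ {x v} → HasValuation x v → q ^ v ∣ x
    q^v∣x (factor u refl _) = m∣m*n u

    valuation-unit : ∀ {u} → ¬ q ∣ u → HasValuation u 0
    valuation-unit {u} q∤u = factor u (sym (*-identityˡ u)) q∤u

    valuation-* : ∀ {x y e f} → HasValuation x e → HasValuation y f → HasValuation (x * y) (e + f)
    valuation-* {e = e} {f} (factor u refl q∤u) (factor v refl q∤v) =
      factor (u * v) (trans (regroup (q ^ e) u (q ^ f) v) (cong (_* (u * v)) (sym (^-distribˡ-+-* q e f)))) (q∤* q∤u q∤v)
      where
      regroup : ∀ a u b v → a * u * (b * v) ≡ a * b * (u * v)
      regroup = solve-∀

    valuation-prodFin : ∀ {k} (g e : Fin k → ℕ) → (∀ i → HasValuation (g i) (e i)) →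
                        HasValuation (prodFin g) (sumFin e)
    valuation-prodFin {zero}  g e val = valuation-unit q∤1
    valuation-prodFin {suc k} g e val = valuation-* (val zero) (valuation-prodFin (g ∘ suc) (e ∘ suc) (val ∘ suc))

    valuation-maximal : ∀ {x e} → HasValuation x e → ¬ q ^ suc e ∣ x
    valuation-maximal {e = e} (factor u refl q∤u) q^[1+e]∣x =
      q∤u (*-cancelˡ-∣ {q} {u} (q ^ e) {{m^n≢0 q e}} (subst (_∣ q ^ e * u) (*-comm q (q ^ e)) q^[1+e]∣x))

    ∣⇒≤valuation : ∀ {x v e} → HasValuation x v → q ^ e ∣ x → e ≤ v
    ∣⇒≤valuation {v = v} {e} val q^e∣x with e ≤? v
    ... | yes e≤v = e≤v
    ... | no  e≰v = contradiction (∣-trans (q^-∣-mono (≰⇒> e≰v)) q^e∣x) (valuation-maximal val)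

    valuation<J : ∀ {x e J} → HasValuation x e → ¬ q ^ J ∣ x → e < J
    valuation<J {e = e} {J} (factor u refl _) q^J∤x with e <? J
    ... | yes e<J = e<J
    ... | no  e≮J = contradiction (∣m⇒∣m*n u (q^-∣-mono (≮⇒≥ e≮J))) q^J∤x

    valuation-prodFin-bounded : ∀ {k} (g J : Fin k → ℕ) → (∀ i → g i ≢ 0) → (∀ i → ¬ q ^ J i ∣ g i) →
                                Σ ℕ λ v → HasValuation (prodFin g) v × v ≤ sumFin J
    valuation-prodFin-bounded g J g≢0 q^J∤g =
      sumFin (proj₁ ∘ val) , valuation-prodFin g (proj₁ ∘ val) (proj₂ ∘ val) ,
      sumFin-mono (λ i → <⇒≤ (valuation<J (proj₂ (val i)) (q^J∤g i)))
      where
      val : ∀ i → Σ ℕ (HasValuation (g i))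
      val i = valuation-exists (g i) (g≢0 i)

    q^a∣x∧m∣x⇒q^a*m∣x : ∀ a {m x} → ¬ q ∣ m → q ^ a ∣ x → m ∣ x → q ^ a * m ∣ x
    q^a∣x∧m∣x⇒q^a*m∣x a {m} q∤m q^a∣x (divides y refl) =
      *-monoˡ-∣ m (q^e∣u*x⇒q^e∣x a q∤m (subst (q ^ a ∣_) (*-comm y m) q^a∣x))

    q^[e+a]∣x*s⇒q^a∣s : ∀ {x e} a {s} → HasValuation x e → q ^ (e + a) ∣ x * s → q ^ a ∣ s
    q^[e+a]∣x*s⇒q^a∣s {e = e} a {s} (factor u refl q∤u) q^[e+a]∣xs =
      q^e∣u*x⇒q^e∣x a q∤u (*-cancelˡ-∣ {q ^ a} {u * s} (q ^ e) {{m^n≢0 q e}}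
        (subst₂ _∣_ (^-distribˡ-+-* q e a) (*-assoc (q ^ e) u s) q^[e+a]∣xs))

    valuation-q^ : ∀ e → HasValuation (q ^ e) e
    valuation-q^ e = factor 1 (sym (*-identityʳ (q ^ e))) q∤1

  prime-divisor : ∀ n → 2 ≤ n → Σ ℕ λ q → Prime q × q ∣ n
  prime-divisor n 2≤n with factorise n {{>-nonZero (<-trans z<s 2≤n)}}
  ... | record { factors = [] ; isFactorisation = n≡1 } = contradiction n≡1 (>⇒≢ 2≤n)
  ... | record { factors = q ∷ qs ; isFactorisation = eq ; factorsPrime = q-prime ∷ _ } =
    q , q-prime , divides (product qs) (trans eq (*-comm q (product qs)))

  prime-above : ∀ H → Σ ℕ λ q → Prime q × H < q
  prime-above H with prime-divisor (H ! + 1) (+-monoˡ-≤ 1 (n≢0⇒n>0 (≢-nonZero⁻¹ (H !) {{H !≢0}})))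
  ... | q , q-prime , q∣H!+1 with H <? q
  ...   | yes H<q = q , q-prime , H<q
  ...   | no  H≮q = contradiction (∣m+n∣m⇒∣n q∣H!+1 q∣H!) (Valuation.q∤1 q q-prime)
    where
    q∣H! : q ∣ H !
    q∣H! = ∣-trans (subst (λ x → x ∣ x !) (suc-pred q {{prime⇒nonZero q-prime}}) (m∣m*n (pred q !)))
                   (m≤n⇒m!∣n! (≮⇒≥ H≮q))

  prime-power-induction : (Pr : ℕ → Set) → Pr 1 →
    (∀ q e m → Prime q → ¬ q ∣ m → Pr m → Pr (q ^ suc e * m)) → ∀ m → 0 < m → Pr m
  prime-power-induction Pr Pr1 step = <-rec _ go
    where
    go : ∀ m → (∀ {m′} → m′ < m → 0 < m′ → Pr m′) → 0 < m → Pr m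
    go (suc zero)    rec _ = Pr1
    go (suc (suc n)) rec _ with prime-divisor (suc (suc n)) (s≤s (s≤s z≤n))
    ... | q , q-prime , q∣m with Valuation.valuation-exists q q-prime (suc (suc n)) (λ ())
    ...   | zero  , Valuation.factor m′ m≡m′ q∤m′ =
      contradiction (subst (q ∣_) (trans m≡m′ (*-identityˡ m′)) q∣m) q∤m′
    ...   | suc e , Valuation.factor m′ m≡q^[1+e]*m′ q∤m′ =
      subst Pr (sym m≡q^[1+e]*m′) (step q e m′ q-prime q∤m′ (rec m′<m 0<m′))
      where
      open Valuation q q-prime using (1<q; q≢0)
      0<m′ : 0 < m′
      0<m′ = n≢0⇒n>0 (λ m′≡0 → 0≢1+n (trans (trans (sym (*-zeroʳ (q ^ suc e))) (cong (q ^ suc e *_) (sym m′≡0)))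
                                             (sym m≡q^[1+e]*m′)))
      m′<m : m′ < suc (suc n)
      m′<m = subst (m′ <_) (trans (*-comm m′ _) (sym m≡q^[1+e]*m′))
                   (m<m*n m′ (q ^ suc e) {{>-nonZero 0<m′}} (<-≤-trans 1<q (m≤m*n q (q ^ e) {{m^n≢0 q e}})))

module Legendre (q : ℕ) (q-prime : Prime q) where

  open import Data.Nat
  open import Data.Nat.Properties
  open import Data.Nat.Divisibility
  open import Data.Nat.DivMod
  open import Data.Nat.Primality
  open import Data.Nat.Tactic.RingSolver using (solve-∀)
  open import Data.Product using (Σ; _×_; _,_)
  open import Relation.Binary.PropositionalEquality
  open import Relation.Nullary using (¬_)
  open FiniteSums
  open PrimeValuation

  open Valuation q q-prime

  FactorialSplit : ℕ → ℕ → Set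
  FactorialSplit y r = Σ ℕ λ R → (q * y + r) ! ≡ q ^ y * (y ! * R) × ¬ q ∣ R

  private
    q-1 : ℕ
    q-1 = pred q

    q≡1+q-1 : q ≡ suc q-1
    q≡1+q-1 = sym (suc-pred q)

    q*[1+y]≡1+q*y+q-1 : ∀ y → q * suc y + 0 ≡ suc (q * y + q-1)
    q*[1+y]≡1+q*y+q-1 y = begin
      q * suc y + 0     ≡⟨ +-identityʳ _ ⟩
      q * suc y         ≡⟨ *-suc q y ⟩
      q + q * y         ≡⟨ cong (_+ q * y) q≡1+q-1 ⟩
      suc (q-1 + q * y) ≡⟨ cong suc (+-comm q-1 (q * y)) ⟩
      suc (q * y + q-1) ∎
      where open ≡-Reasoning

    regroup : ∀ a b c d → a * (b * (c * d)) ≡ b * (c * (a * d))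
    regroup = solve-∀

  mutual
    factorial-split-multiple : ∀ y → FactorialSplit y 0
    factorial-split-multiple zero    = 1 , cong _! (trans (+-identityʳ (q * 0)) (*-zeroʳ q)) , q∤1
    factorial-split-multiple (suc y) with factorial-split-offset y q-1 (subst (q-1 <_) (sym q≡1+q-1) (n<1+n q-1))
    ... | R , eq , q∤R = R , eq′ , q∤R
      where
      open ≡-Reasoning
      eq′ : (q * suc y + 0) ! ≡ q ^ suc y * (suc y ! * R)
      eq′ = begin
        (q * suc y + 0) !                             ≡⟨ cong _! (q*[1+y]≡1+q*y+q-1 y) ⟩
        suc (q * y + q-1) * (q * y + q-1) !           ≡⟨ cong₂ (λ a b → a * b) (sym (q*[1+y]≡1+q*y+q-1 y)) eq ⟩
        (q * suc y + 0) * (q ^ y * (y ! * R))         ≡⟨ rearrange q y (q ^ y) (y !) R ⟩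
        q * q ^ y * (suc y * y ! * R)                 ∎
        where
        rearrange : ∀ q y a b R → (q * suc y + 0) * (a * (b * R)) ≡ q * a * (suc y * b * R)
        rearrange = solve-∀

    factorial-split-offset : ∀ y r → r < q → FactorialSplit y r
    factorial-split-offset y zero    _   = factorial-split-multiple y
    factorial-split-offset y (suc r) r<q with factorial-split-offset y r (<-trans (n<1+n r) r<q)
    ... | R , eq , q∤R = (q * y + suc r) * R , eq′ , q∤* q∤new q∤R
      where
      q∤new : ¬ q ∣ q * y + suc r
      q∤new q∣ = <⇒≱ r<q (∣⇒≤ (∣m+n∣m⇒∣n q∣ (m∣m*n y)))
      open ≡-Reasoning
      eq′ : (q * y + suc r) ! ≡ q ^ y * (y ! * ((q * y + suc r) * R))
      eq′ = begin
        (q * y + suc r) !                          ≡⟨ cong _! (+-suc (q * y) r) ⟩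
        suc (q * y + r) * (q * y + r) !            ≡⟨ cong (suc (q * y + r) *_) eq ⟩
        suc (q * y + r) * (q ^ y * (y ! * R))      ≡⟨ regroup (suc (q * y + r)) (q ^ y) (y !) R ⟩
        q ^ y * (y ! * (suc (q * y + r) * R))      ≡⟨ cong (λ a → q ^ y * (y ! * (a * R))) (sym (+-suc (q * y) r)) ⟩
        q ^ y * (y ! * ((q * y + suc r) * R))      ∎

  factorial-split : ∀ N → Σ ℕ λ R → N ! ≡ q ^ (N / q) * ((N / q) ! * R) × ¬ q ∣ R
  factorial-split N with factorial-split-offset (N / q) (N % q) (m%n<n N q)
  ... | R , eq , q∤R = R , trans (cong _! N≡q*[N/q]+N%q) eq , q∤R
    where
    N≡q*[N/q]+N%q : N ≡ q * (N / q) + N % q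
    N≡q*[N/q]+N%q = trans (m≡m%n+[m/n]*n N q) (trans (+-comm (N % q) _) (cong (_+ N % q) (*-comm (N / q) q)))

  N/q¹≡N/q : ∀ N → N /q^ 1 ≡ N / q
  N/q¹≡N/q N = /-congʳ {{m^n≢0 q 1}} (*-identityʳ q)

  ν : ℕ → ℕ → ℕ
  ν K N = ∑[ j < K ] (N /q^ suc j)

  ν-suc : ∀ K N → ν (suc K) N ≡ N / q + ν K (N / q)
  ν-suc K N = cong₂ _+_ (N/q¹≡N/q N) (sum<-cong (λ j → sym (N/q/q^j≡N/q^[1+j] (suc j))) K)
    where
    N/q/q^j≡N/q^[1+j] : ∀ j → (N / q) /q^ j ≡ N /q^ suc j
    N/q/q^j≡N/q^[1+j] j = m/n/o≡m/[n*o] N q (q ^ j) {{_}} {{m^n≢0 q j}} {{m^n≢0 q (suc j)}}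

  legendre : ∀ K N → N < q ^ K → HasValuation (N !) (ν K N)
  legendre zero    zero    _ = valuation-unit q∤1
  legendre zero    (suc N) (s<s ())
  legendre (suc K) N N<q^[1+K] with factorial-split N | legendre K (N / q) N/q<q^K
    where
    N/q<q^K : N / q < q ^ K
    N/q<q^K = m<n*o⇒m/o<n (subst (N <_) (*-comm q (q ^ K)) N<q^[1+K])
  ... | R , eq , q∤R | val = subst₂ HasValuation (sym eq) valuation-sum
        (valuation-* (valuation-q^ (N / q)) (valuation-* val (valuation-unit q∤R)))
    where
    valuation-sum : N / q + (ν K (N / q) + 0) ≡ ν (suc K) N
    valuation-sum = trans (cong (N / q +_) (+-identityʳ _)) (sym (ν-suc K N))

  legendre-small : ∀ N → N < q * q → HasValuation (N !) (N / q)
  legendre-small N N<q*q = subst (HasValuation (N !)) ν₂N≡N/q (legendre 2 N N<q²)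
    where
    N<q² : N < q ^ 2
    N<q² = subst (N <_) (cong (q *_) (sym (*-identityʳ q))) N<q*q
    ν₂N≡N/q : ν 2 N ≡ N / q
    ν₂N≡N/q = trans (cong₂ _+_ (N/q¹≡N/q N) (trans (+-identityʳ _) (m<n⇒m/n≡0 {{m^n≢0 q 2}} N<q²))) (+-identityʳ _)

module FiniteDifferences where

  open import Data.Nat as ℕ using (ℕ; zero; suc; _≤_; z≤n; s≤s)
  import Data.Nat.Properties as ℕ
  open import Data.Integer using (ℤ; +_; _+_; _-_; _*_; _≟_)
  import Data.Integer.Properties as ℤ
  open import Data.Integer.Divisibility.Signed using (_∣_; _∣?_; ∣m∣n⇒∣m-n)
  open import Data.Integer.Tactic.RingSolver using (solve-∀)
  open import Data.List using ([]; _∷_; length)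
  open import Data.Product using (Σ; _×_; _,_)
  open import Data.Sum using (_⊎_; inj₁; inj₂)
  open import Function using (_∘_)
  open import Relation.Binary.PropositionalEquality
  open import Relation.Nullary using (¬_; yes; no; ¬?; contradiction; decidable-stable)

  Δ : (ℕ → ℤ) → ℕ → ℤ
  Δ f x = f (suc x) - f x

  Δ^ : ℕ → (ℕ → ℤ) → ℕ → ℤ
  Δ^ zero    f = f
  Δ^ (suc d) f = Δ^ d (Δ f)

  Δ^-suc : ∀ d f x → Δ^ (suc d) f x ≡ Δ^ d f (suc x) - Δ^ d f x
  Δ^-suc zero    f x = refl
  Δ^-suc (suc d) f x = Δ^-suc d (Δ f) x

  Δ^-cong : ∀ d {f g} → (∀ x → f x ≡ g x) → ∀ x → Δ^ d f x ≡ Δ^ d g x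
  Δ^-cong zero    f≗g x = f≗g x
  Δ^-cong (suc d) f≗g x = Δ^-cong d (λ y → cong₂ _-_ (f≗g (suc y)) (f≗g y)) x

  Δ^-shift : ∀ d f x → Δ^ d (f ∘ suc) x ≡ Δ^ d f (suc x)
  Δ^-shift zero    f x = refl
  Δ^-shift (suc d) f x = Δ^-shift d (Δ f) x

  Δ^-+ : ∀ d f g x → Δ^ d (λ y → f y + g y) x ≡ Δ^ d f x + Δ^ d g x
  Δ^-+ zero    f g x = refl
  Δ^-+ (suc d) f g x = trans (Δ^-cong d (λ y → interchange (f (suc y)) (g (suc y)) (f y) (g y)) x) (Δ^-+ d (Δ f) (Δ g) x)
    where
    interchange : ∀ a b c e → (a + b) - (c + e) ≡ (a - c) + (b - e)
    interchange = solve-∀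

  Degree< : ℕ → (ℕ → ℤ) → Set
  Degree< d f = ∀ x → Δ^ d f x ≡ + 0

  degree<-suc : ∀ d {f} → Degree< d f → Degree< (suc d) f
  degree<-suc d {f} deg x = trans (Δ^-suc d f x) (cong₂ _-_ (deg (suc x)) (deg x))

  degree<-+ : ∀ d {f g} → Degree< d f → Degree< d g → Degree< d (λ y → f y + g y)
  degree<-+ d {f} {g} deg-f deg-g x = trans (Δ^-+ d f g x) (cong₂ _+_ (deg-f x) (deg-g x))

  degree<-const : ∀ d c → Degree< (suc d) (λ _ → c)
  degree<-const zero    c x = ℤ.+-inverseʳ c
  degree<-const (suc d) c   = degree<-suc (suc d) {λ _ → c} (degree<-const d c)

  degree<-x* : ∀ d {h} → Degree< d h → Degree< (suc d) (λ y → + y * h y)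
  degree<-x* d {h} deg x =
    trans (Δ^-cong d Δ[x*h] x)
          (degree<-+ d {h ∘ suc} {λ y → + y * Δ h y} (λ y → trans (Δ^-shift d h y) (deg (suc y))) (x*Δh d deg) x)
    where
    Δ[x*h] : ∀ y → Δ (λ y → + y * h y) y ≡ h (suc y) + + y * Δ h y
    Δ[x*h] y = trans (cong (λ a → a * h (suc y) - + y * h y) (sym (ℤ.pos-+ 1 y))) (expand (+ y) (h (suc y)) (h y))
      where
      expand : ∀ a b c → (+ 1 + a) * b - a * c ≡ b + a * (b - c)
      expand = solve-∀
    x*Δh : ∀ d {h} → Degree< d h → Degree< d (λ y → + y * Δ h y)
    x*Δh zero    {h} deg y = trans (cong₂ (λ a b → + y * (a - b)) (deg (suc y)) (deg y)) (ℤ.*-zeroʳ (+ y))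
    x*Δh (suc d) {h} deg   = degree<-x* d (λ y → deg y)

  degree<-evalPoly : ∀ P → Degree< (length P) (λ x → evalPoly P (+ x))
  degree<-evalPoly []       x = refl
  degree<-evalPoly (a ∷ as) = degree<-+ (suc (length as)) {λ _ → a} {λ y → + y * evalPoly as (+ y)}
    (degree<-const (length as) a) (degree<-x* (length as) (degree<-evalPoly as))

  Δ≡0⇒constant : ∀ (g : ℕ → ℤ) → (∀ x → Δ g x ≡ + 0) → ∀ x → g x ≡ g 0
  Δ≡0⇒constant g Δg≡0 zero    = refl
  Δ≡0⇒constant g Δg≡0 (suc x) = trans (ℤ.i-j≡0⇒i≡j (g (suc x)) (g x) (Δg≡0 x)) (Δ≡0⇒constant g Δg≡0 x)

  Δ^-constant : ∀ d f → Degree< (suc d) f → ∀ x → Δ^ d f x ≡ Δ^ d f 0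
  Δ^-constant d f deg = Δ≡0⇒constant (Δ^ d f) (λ x → trans (sym (Δ^-suc d f x)) (deg x))

  zero-or-constant-difference : ∀ d f → Degree< d f →
    (∀ x → f x ≡ + 0) ⊎ Σ ℕ λ d′ → Σ ℤ λ c → c ≢ + 0 × (∀ x → Δ^ d′ f x ≡ c)
  zero-or-constant-difference zero    f deg = inj₁ deg
  zero-or-constant-difference (suc d) f deg with Δ^ d f 0 ≟ + 0
  ... | yes Δ^f0≡0 = zero-or-constant-difference d f (λ x → trans (Δ^-constant d f deg x) Δ^f0≡0)
  ... | no  Δ^f0≢0 = inj₂ (d , Δ^ d f 0 , Δ^f0≢0 , Δ^-constant d f deg)

  ∣window⇒∣Δ^ : ∀ k d f x → (∀ t → t ≤ d → k ∣ f (x ℕ.+ t)) → k ∣ Δ^ d f x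
  ∣window⇒∣Δ^ k zero    f x ∣f = subst (λ y → k ∣ f y) (ℕ.+-identityʳ x) (∣f 0 z≤n)
  ∣window⇒∣Δ^ k (suc d) f x ∣f = subst (k ∣_) (sym (Δ^-suc d f x)) (∣m∣n⇒∣m-n
    (∣window⇒∣Δ^ k d f (suc x) (λ t t≤d → subst (λ y → k ∣ f y) (ℕ.+-suc x t) (∣f (suc t) (s≤s t≤d))))
    (∣window⇒∣Δ^ k d f x (λ t t≤d → ∣f t (ℕ.m≤n⇒m≤1+n t≤d))))

  WindowsEscapeDivisors : ℕ → ℤ → (ℕ → ℤ) → Set
  WindowsEscapeDivisors d c f = ∀ k → ¬ k ∣ c → ∀ x → Σ ℕ λ t → t ≤ d × ¬ k ∣ f (x ℕ.+ t)

  polynomial-zero-or-escapes : ∀ P → (∀ n → evalPoly P (+ n) ≡ + 0) ⊎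
    Σ ℕ λ d → Σ ℤ λ c → c ≢ + 0 × WindowsEscapeDivisors d c (λ n → evalPoly P (+ n))
  polynomial-zero-or-escapes P with zero-or-constant-difference (length P) (λ n → evalPoly P (+ n)) (degree<-evalPoly P)
  ... | inj₁ P≡0 = inj₁ P≡0
  ... | inj₂ (d , c , c≢0 , Δ^P≡c) = inj₂ (d , c , c≢0 , escape)
    where
    f : ℕ → ℤ
    f n = evalPoly P (+ n)
    escape : WindowsEscapeDivisors d c f
    escape k k∤c x with ℕ.anyUpTo? (λ t → ¬? (k ∣? f (x ℕ.+ t))) (suc d)
    ... | yes (t , s≤s t≤d , k∤f) = t , t≤d , k∤f
    ... | no  none = contradiction (subst (k ∣_) (Δ^P≡c x) (∣window⇒∣Δ^ k d f x all-divide)) k∤c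
      where
      all-divide : ∀ t → t ≤ d → k ∣ f (x ℕ.+ t)
      all-divide t t≤d = decidable-stable (k ∣? f (x ℕ.+ t)) (λ k∤f → none (t , s≤s t≤d , k∤f))

module FloorArithmetic where

  open import Data.Nat
  open import Data.Nat.Properties
  open import Data.Nat.Divisibility
  open import Data.Nat.DivMod
  open import Data.Nat.Tactic.RingSolver using (solve-∀)
  open import Data.Product using (_,_)
  open import Relation.Binary.PropositionalEquality
  open import Relation.Nullary using (yes; no; contradiction)
  open FiniteSums using (𝟙)

  floor-unique : ∀ X Q f .{{_ : NonZero Q}} → f * Q ≤ X → X < suc f * Q → X / Q ≡ f
  floor-unique X Q f lo hi with m≤n⇒∃[o]m+o≡n lo
  ... | e , refl = begin
    (f * Q + e) / Q  ≡⟨ +-distrib-/-∣ˡ e (divides f refl) ⟩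
    f * Q / Q + e / Q ≡⟨ cong₂ _+_ (m*n/n≡m f Q) (m<n⇒m/n≡0 e<Q) ⟩
    f + 0             ≡⟨ +-identityʳ f ⟩
    f                 ∎
    where
    open ≡-Reasoning
    e<Q : e < Q
    e<Q = +-cancelˡ-< (f * Q) e Q (subst (f * Q + e <_) (+-comm Q (f * Q)) hi)

  m<[1+m/n]*n : ∀ m n .{{_ : NonZero n}} → m < suc (m / n) * n
  m<[1+m/n]*n m n = begin-strict
    m                  ≡⟨ m≡m%n+[m/n]*n m n ⟩
    m % n + m / n * n  <⟨ +-monoˡ-< _ (m%n<n m n) ⟩
    suc (m / n) * n    ∎
    where open ≤-Reasoning

  floor-*-approx : ∀ C y z r Q δ .{{_ : NonZero z}} .{{_ : NonZero Q}} →
                   r * z ≡ y * Q + δ → C * δ < Q → C * r / Q ≡ C * y / z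
  floor-*-approx C y z r Q δ rz≡yQ+δ Cδ<Q = floor-unique (C * r) Q f lo hi
    where
    f : ℕ
    f = C * y / z
    Crz≡CyQ+Cδ : C * r * z ≡ C * y * Q + C * δ
    Crz≡CyQ+Cδ = trans (*-assoc C r z) (trans (cong (C *_) rz≡yQ+δ) (distrib C y Q δ))
      where
      distrib : ∀ C y Q δ → C * (y * Q + δ) ≡ C * y * Q + C * δ
      distrib = solve-∀
    swap : ∀ a b c → a * b * c ≡ a * c * b
    swap = solve-∀
    lo : f * Q ≤ C * r
    lo = *-cancelʳ-≤ (f * Q) (C * r) z (begin
      f * Q * z          ≡⟨ swap f Q z ⟩
      f * z * Q          ≤⟨ *-monoˡ-≤ Q (m/n*n≤m (C * y) z) ⟩
      C * y * Q          ≤⟨ m≤m+n _ _ ⟩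
      C * y * Q + C * δ  ≡⟨ Crz≡CyQ+Cδ ⟨
      C * r * z          ∎)
      where open ≤-Reasoning
    hi : C * r < suc f * Q
    hi = *-cancelʳ-< z (C * r) (suc f * Q) (begin-strict
      C * r * z          ≡⟨ Crz≡CyQ+Cδ ⟩
      C * y * Q + C * δ  <⟨ +-monoʳ-< (C * y * Q) Cδ<Q ⟩
      C * y * Q + Q      ≡⟨ +-comm (C * y * Q) Q ⟩
      suc (C * y) * Q    ≤⟨ *-monoˡ-≤ Q (m<[1+m/n]*n (C * y) z) ⟩
      suc f * z * Q      ≡⟨ swap (suc f) z Q ⟩
      suc f * Q * z      ∎)
      where open ≤-Reasoning

  floor-*-shift : ∀ C t r Q .{{_ : NonZero Q}} → C * (t * Q + r) / Q ≡ C * t + C * r / Q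
  floor-*-shift C t r Q = begin
    C * (t * Q + r) / Q          ≡⟨ cong (_/ Q) (distrib C t Q r) ⟩
    (C * t * Q + C * r) / Q      ≡⟨ +-distrib-/-∣ˡ (C * r) (divides (C * t) refl) ⟩
    C * t * Q / Q + C * r / Q    ≡⟨ cong (_+ C * r / Q) (m*n/n≡m (C * t) Q) ⟩
    C * t + C * r / Q            ∎
    where
    open ≡-Reasoning
    distrib : ∀ C t Q r → C * (t * Q + r) ≡ C * t * Q + C * r
    distrib = solve-∀

  floor-[cu+v]K/[1+cK] : ∀ u v c K → 0 < v → v ≤ c → u < K → (c * u + v) * K / suc (c * K) ≡ u
  floor-[cu+v]K/[1+cK] u v c K 0<v v≤c u<K = floor-unique _ _ u lo hi
    where
    open ≤-Reasoning
    expand₁ : ∀ u c K → u * suc (c * K) ≡ u + c * u * K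
    expand₁ = solve-∀
    expand₂ : ∀ u v c K → v * K + c * u * K ≡ (c * u + v) * K
    expand₂ = solve-∀
    expand₃ : ∀ u c K → c * K + c * u * K + suc u ≡ suc u * suc (c * K)
    expand₃ = solve-∀
    lo : u * suc (c * K) ≤ (c * u + v) * K
    lo = begin
      u * suc (c * K)      ≡⟨ expand₁ u c K ⟩
      u + c * u * K        ≤⟨ +-monoˡ-≤ _ (≤-trans (<⇒≤ u<K) (m≤n*m K v {{>-nonZero 0<v}})) ⟩
      v * K + c * u * K    ≡⟨ expand₂ u v c K ⟩
      (c * u + v) * K      ∎
    hi : (c * u + v) * K < suc u * suc (c * K)
    hi = begin-strict
      (c * u + v) * K            ≡⟨ expand₂ u v c K ⟨
      v * K + c * u * K          ≤⟨ +-monoˡ-≤ _ (*-monoˡ-≤ K v≤c) ⟩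
      c * K + c * u * K          <⟨ m<m+n _ {suc u} z<s ⟩
      c * K + c * u * K + suc u  ≡⟨ expand₃ u c K ⟩
      suc u * suc (c * K)        ∎

  floor-divisibility-jump : ∀ C c K .{{_ : NonZero c}} → 0 < C → C < K →
                            C * K / suc (c * K) + 𝟙 (c ∣? C) ≡ C / c
  floor-divisibility-jump C c K 0<C C<K with c ∣? C
  ... | yes (divides zero    C≡0)  = contradiction C≡0 (≢-nonZero⁻¹ C {{>-nonZero 0<C}})
  ... | yes (divides (suc u) refl) = begin
    suc u * c * K / suc (c * K) + 1    ≡⟨ cong (λ x → x * K / suc (c * K) + 1) (multiple u c) ⟩
    (c * u + c) * K / suc (c * K) + 1  ≡⟨ cong (_+ 1) (floor-[cu+v]K/[1+cK] u c c K (>-nonZero⁻¹ c) ≤-refl u<K) ⟩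
    u + 1                              ≡⟨ +-comm u 1 ⟩
    suc u                              ≡⟨ m*n/n≡m (suc u) c ⟨
    suc u * c / c                      ∎
    where
    open ≡-Reasoning
    multiple : ∀ u c → suc u * c ≡ c * u + c
    multiple = solve-∀
    u<K : u < K
    u<K = ≤-<-trans (≤-trans (n≤1+n u) (m≤m*n (suc u) c)) C<K
  ... | no  c∤C = begin
    C * K / suc (c * K) + 0                    ≡⟨ +-identityʳ _ ⟩
    C * K / suc (c * K)                        ≡⟨ cong (λ x → x * K / suc (c * K)) C≡c*[C/c]+C%c ⟩
    (c * (C / c) + C % c) * K / suc (c * K)    ≡⟨ floor-[cu+v]K/[1+cK] (C / c) (C % c) c K 0<C%c (<⇒≤ (m%n<n C c)) C/c<K ⟩
    C / c                                      ∎
    where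
    open ≡-Reasoning
    C≡c*[C/c]+C%c : C ≡ c * (C / c) + C % c
    C≡c*[C/c]+C%c = trans (m≡m%n+[m/n]*n C c) (trans (+-comm (C % c) _) (cong (_+ C % c) (*-comm (C / c) c)))
    0<C%c : 0 < C % c
    0<C%c = n≢0⇒n>0 (λ C%c≡0 → c∤C (m%n≡0⇒n∣m C c C%c≡0))
    C/c<K : C / c < K
    C/c<K = ≤-<-trans (m/n≤m C c) C<K

module Multiplicities where

  open import Data.Nat
  open import Data.Nat.Properties
  open import Data.Nat.Divisibility
  open import Data.Fin using (Fin; zero; suc)
  open import Data.Product using (∃; _×_; _,_)
  open import Function using (_∘_)
  open import Function.Bundles using (_⇔_; mk⇔; Equivalence)
  open import Relation.Binary.PropositionalEquality
  open import Relation.Nullary using (Dec; yes; no; contradiction)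
  open import Relation.Nullary.Decidable using (_×-dec_)
  open FiniteSums

  module _ {k : ℕ} where

    multiplicity : ℕ → (Fin k → ℕ) → ℕ
    multiplicity x C = sumFin (λ i → 𝟙 (C i ≟ x))

    divisorCount : ℕ → (Fin k → ℕ) → ℕ
    divisorCount c C = sumFin (λ i → 𝟙 (c ∣? C i))

  sumFin-fibres : ∀ {k} (g : ℕ → ℕ) (C : Fin k → ℕ) B → (∀ i → C i < B) →
                  sumFin (g ∘ C) ≡ ∑[ e < B ] (g e * multiplicity e C)
  sumFin-fibres g C B C<B = begin
    sumFin (g ∘ C)                                        ≡⟨ sumFin-cong (λ i → sum<-select g B (C<B i)) ⟨
    sumFin (λ i → ∑[ e < B ] (g e * 𝟙 (C i ≟ e)))         ≡⟨ sum<-sumFin (λ i e → g e * 𝟙 (C i ≟ e)) B ⟨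
    ∑[ e < B ] sumFin (λ i → g e * 𝟙 (C i ≟ e))           ≡⟨ sum<-cong (λ e → sumFin-*ˡ (g e) (λ i → 𝟙 (C i ≟ e))) B ⟩
    ∑[ e < B ] (g e * multiplicity e C)                   ∎
    where open ≡-Reasoning

  multiplicity-absent : ∀ {k} (C : Fin k → ℕ) {x} → (∀ i → C i ≢ x) → multiplicity x C ≡ 0
  multiplicity-absent {k} C {x} absent = begin
    multiplicity x C           ≡⟨ sumFin-cong (λ i → 𝟙-no (C i ≟ x) (absent i)) ⟩
    sumFin {k} (λ _ → 0)       ≡⟨ sumFin-const {k} 0 ⟩
    k * 0                      ≡⟨ *-zeroʳ k ⟩
    0                          ∎
    where open ≡-Reasoning

  value⇔multiplicity>0 : ∀ {k} (C : Fin k → ℕ) x → (∃ λ i → C i ≡ x) ⇔ 0 < multiplicity x C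
  value⇔multiplicity>0 C x = mk⇔ to from
    where
    to : ∀ {k} {C : Fin k → ℕ} → (∃ λ i → C i ≡ x) → 0 < multiplicity x C
    to {C = C} (i , Ci≡x) = ≤-trans (≤-reflexive (sym (𝟙-yes (C i ≟ x) Ci≡x))) (f≤sumFin (λ i → 𝟙 (C i ≟ x)) i)
    from : ∀ {k} {C : Fin k → ℕ} → 0 < multiplicity x C → ∃ λ i → C i ≡ x
    from {zero}          ()
    from {suc k} {C} m>0 with C zero ≟ x
    ... | yes C0≡x = zero , C0≡x
    ... | no  _    with from {C = C ∘ suc} m>0
    ...   | i , Ci≡x = suc i , Ci≡x

  module _ {r s : ℕ} (C : Fin r → ℕ) (D : Fin s → ℕ) (C-pos : ∀ i → 0 < C i) (D-pos : ∀ j → 0 < D j)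
           (same-counts : ∀ c → 0 < c → divisorCount c C ≡ divisorCount c D) where

    private
      B : ℕ
      B = suc (sumFin C + sumFin D)

      C<B : ∀ i → C i < B
      C<B i = s≤s (≤-trans (f≤sumFin C i) (m≤m+n _ _))

      D<B : ∀ j → D j < B
      D<B j = s≤s (≤-trans (f≤sumFin D j) (m≤n+m _ _))

      ProperDivisor? : ∀ c y → Dec (c ∣ y × c < y)
      ProperDivisor? c y = (c ∣? y) ×-dec (c <? y)

      𝟙-divides-split : ∀ c y → 0 < y → 𝟙 (c ∣? y) ≡ 𝟙 (y ≟ c) + 𝟙 (ProperDivisor? c y)
      𝟙-divides-split c y 0<y with c ∣? y | y ≟ c | ProperDivisor? c y
      ... | yes _   | yes refl | yes (_ , c<c)  = contradiction c<c (<-irrefl refl)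
      ... | yes _   | yes _    | no _           = refl
      ... | yes _   | no _     | yes _          = refl
      ... | yes c∣y | no y≢c   | no ¬proper     =
        contradiction (c∣y , ≤∧≢⇒< (∣⇒≤ {{>-nonZero 0<y}} c∣y) (y≢c ∘ sym)) ¬proper
      ... | no c∤y  | yes refl | _              = contradiction ∣-refl c∤y
      ... | no c∤y  | no _     | yes (c∣y , _)  = contradiction c∣y c∤y
      ... | no _    | no _     | no _           = refl

      divisorCount-split : ∀ {k} (G : Fin k → ℕ) → (∀ i → 0 < G i) → (∀ i → G i < B) → ∀ c →
        divisorCount c G ≡ multiplicity c G + ∑[ e < B ] (𝟙 (ProperDivisor? c e) * multiplicity e G)
      divisorCount-split G G-pos G<B c = begin
        divisorCount c G                                       ≡⟨ sumFin-cong (λ i → 𝟙-divides-split c (G i) (G-pos i)) ⟩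
        sumFin (λ i → 𝟙 (G i ≟ c) + proper (G i))               ≡⟨ sumFin-+ (λ i → 𝟙 (G i ≟ c)) (proper ∘ G) ⟩
        multiplicity c G + sumFin (proper ∘ G)                  ≡⟨ cong (multiplicity c G +_) (sumFin-fibres proper G B G<B) ⟩
        multiplicity c G + ∑[ e < B ] (proper e * multiplicity e G) ∎
        where
        open ≡-Reasoning
        proper : ℕ → ℕ
        proper e = 𝟙 (ProperDivisor? c e)

      multiplicity-from-above : ∀ x → 0 < x → (∀ e → x < e → multiplicity e C ≡ multiplicity e D) →
                                multiplicity x C ≡ multiplicity x D
      multiplicity-from-above x 0<x above = +-cancelʳ-≡ _ _ _ (begin
        multiplicity x C + ∑[ e < B ] (𝟙 (ProperDivisor? x e) * multiplicity e C) ≡⟨ divisorCount-split C C-pos C<B x ⟨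
        divisorCount x C                                                         ≡⟨ same-counts x 0<x ⟩
        divisorCount x D                                                         ≡⟨ divisorCount-split D D-pos D<B x ⟩
        multiplicity x D + ∑[ e < B ] (𝟙 (ProperDivisor? x e) * multiplicity e D) ≡⟨ cong (multiplicity x D +_) (sum<-cong proper B) ⟨
        multiplicity x D + ∑[ e < B ] (𝟙 (ProperDivisor? x e) * multiplicity e C) ∎)
        where
        open ≡-Reasoning
        proper : ∀ e → 𝟙 (ProperDivisor? x e) * multiplicity e C ≡ 𝟙 (ProperDivisor? x e) * multiplicity e D
        proper e with ProperDivisor? x e
        ... | yes (_ , x<e) = cong (1 *_) (above e x<e)
        ... | no _          = refl

      multiplicity-downwards : ∀ g x → B ≤ x + g → multiplicity x C ≡ multiplicity x D
      multiplicity-downwards _       zero    _ =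
        trans (multiplicity-absent C (λ i → >⇒≢ (C-pos i))) (sym (multiplicity-absent D (λ j → >⇒≢ (D-pos j))))
      multiplicity-downwards zero    (suc x) B≤x+0 =
        trans (multiplicity-absent C (λ i → <⇒≢ (<-≤-trans (C<B i) B≤x)))
              (sym (multiplicity-absent D (λ j → <⇒≢ (<-≤-trans (D<B j) B≤x))))
        where
        B≤x : B ≤ suc x
        B≤x = subst (B ≤_) (+-identityʳ (suc x)) B≤x+0
      multiplicity-downwards (suc g) (suc x) B≤x+g = multiplicity-from-above (suc x) z<s
        (λ e x<e → multiplicity-downwards g e (≤-trans B≤x+g (subst (_≤ e + g) (sym (+-suc (suc x) g)) (+-monoˡ-≤ g x<e))))

    same-divisor-counts⇒same-values : ∀ x → (∃ λ i → C i ≡ x) ⇔ (∃ λ j → D j ≡ x)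
    same-divisor-counts⇒same-values x = mk⇔
      (λ Cx → from D (subst (0 <_) same-multiplicity (to C Cx)))
      (λ Dx → from C (subst (0 <_) (sym same-multiplicity) (to D Dx)))
      where
      to : ∀ {k} (G : Fin k → ℕ) → (∃ λ i → G i ≡ x) → 0 < multiplicity x G
      to G = Equivalence.to (value⇔multiplicity>0 G x)
      from : ∀ {k} (G : Fin k → ℕ) → 0 < multiplicity x G → ∃ λ i → G i ≡ x
      from G = Equivalence.from (value⇔multiplicity>0 G x)
      same-multiplicity : multiplicity x C ≡ multiplicity x D
      same-multiplicity = multiplicity-downwards B x (m≤n+m B x)

module DigitDensity where

  open import Data.Nat
  open import Data.Nat.Properties
  open import Data.Nat.Divisibility using (divides)
  open import Data.Nat.DivMod
  open import Data.Nat.Tactic.RingSolver using (solve-∀)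
  open import Data.Product using (Σ; _,_)
  open import Relation.Binary.PropositionalEquality
  open import Relation.Nullary using (yes; no)
  open FiniteSums

  a^j*[a+j]≤[1+a]^j*a : ∀ a j → a ^ j * (a + j) ≤ suc a ^ j * a
  a^j*[a+j]≤[1+a]^j*a a zero    = ≤-reflexive (+-identityʳ (a + 0))
  a^j*[a+j]≤[1+a]^j*a a (suc j) = begin
    a * a ^ j * (a + suc j)            ≡⟨ expand a (a ^ j) j ⟩
    a * (a ^ j * (a + j)) + a * a ^ j  ≤⟨ +-mono-≤ (*-monoʳ-≤ a (a^j*[a+j]≤[1+a]^j*a a j))
                                                  (*-monoʳ-≤ a (^-monoˡ-≤ j (n≤1+n a))) ⟩
    a * (suc a ^ j * a) + a * suc a ^ j ≡⟨ collect a (suc a ^ j) ⟩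
    suc a * suc a ^ j * a              ∎
    where
    open ≤-Reasoning
    expand : ∀ a p j → a * p * (a + suc j) ≡ a * (p * (a + j)) + a * p
    expand = solve-∀
    collect : ∀ a p → a * (p * a) + a * p ≡ suc a * p * a
    collect = solve-∀

  K*a^[aK]≤[1+a]^[aK] : ∀ a K → 0 < a → K * a ^ (a * K) ≤ suc a ^ (a * K)
  K*a^[aK]≤[1+a]^[aK] a K 0<a = *-cancelˡ-≤ a {{>-nonZero 0<a}} (begin
    a * (K * p)          ≤⟨ m≤n+m _ (p * a) ⟩
    p * a + a * (K * p)  ≡⟨ collect a K p ⟩
    p * (a + a * K)      ≤⟨ a^j*[a+j]≤[1+a]^j*a a (a * K) ⟩
    suc a ^ (a * K) * a  ≡⟨ *-comm _ a ⟩
    a * suc a ^ (a * K)  ∎)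
    where
    open ≤-Reasoning
    p : ℕ
    p = a ^ (a * K)
    collect : ∀ a K p → p * a + a * (K * p) ≡ p * (a + a * K)
    collect = solve-∀

  module Digits (a : ℕ) (0<a : 0 < a) (w : ℕ) (w<Q : w < suc a) where

    Q : ℕ
    Q = suc a

    digitCount : ℕ → ℕ → ℕ
    digitCount zero    n = 0
    digitCount (suc M) n = 𝟙 (n % Q ≟ w) + digitCount M (n / Q)

    fewCount : ℕ → ℕ → ℕ
    fewCount M R = ∑[ n < Q ^ M ] 𝟙 (digitCount M n <? R)

    private
      [Q*x+d]%Q≡d : ∀ x d → d < Q → (Q * x + d) % Q ≡ d
      [Q*x+d]%Q≡d x d d<Q = begin
        (Q * x + d) % Q  ≡⟨ cong (_% Q) (trans (+-comm (Q * x) d) (cong (d +_) (*-comm Q x))) ⟩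
        (d + x * Q) % Q  ≡⟨ [m+kn]%n≡m%n d x Q ⟩
        d % Q            ≡⟨ m<n⇒m%n≡m d<Q ⟩
        d                ∎
        where open ≡-Reasoning

      [Q*x+d]/Q≡x : ∀ x d → d < Q → (Q * x + d) / Q ≡ x
      [Q*x+d]/Q≡x x d d<Q = begin
        (Q * x + d) / Q      ≡⟨ +-distrib-/-∣ˡ d (divides x (*-comm Q x)) ⟩
        Q * x / Q + d / Q    ≡⟨ cong₂ _+_ (trans (cong (_/ Q) (*-comm Q x)) (m*n/n≡m x Q)) (m<n⇒m/n≡0 d<Q) ⟩
        x + 0                ≡⟨ +-identityʳ x ⟩
        x                    ∎
        where open ≡-Reasoning

      digit-block : ∀ m R → ∑[ d < Q ] 𝟙 (𝟙 (d ≟ w) + m <? suc R) ≡ 𝟙 (m <? R) + a * 𝟙 (m <? suc R)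
      digit-block m R = begin
        ∑[ d < Q ] 𝟙 (𝟙 (d ≟ w) + m <? suc R)                   ≡⟨ sum<-cong split Q ⟩
        ∑[ d < Q ] (lo * is-w d + hi * (1 ∸ is-w d))            ≡⟨ sum<-+ (λ d → lo * is-w d) (λ d → hi * (1 ∸ is-w d)) Q ⟩
        ∑[ d < Q ] (lo * is-w d) + ∑[ d < Q ] (hi * (1 ∸ is-w d)) ≡⟨ cong₂ _+_ (sum<-*ˡ lo is-w Q) (sum<-*ˡ hi (λ d → 1 ∸ is-w d) Q) ⟩
        lo * #w + hi * #other                                   ≡⟨ cong₂ (λ x y → lo * x + hi * y) #w≡1 #other≡a ⟩
        lo * 1 + hi * a                                         ≡⟨ cong₂ _+_ (*-identityʳ lo) (*-comm hi a) ⟩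
        lo + a * hi                                             ∎
        where
        open ≡-Reasoning
        is-w : ℕ → ℕ
        is-w d = 𝟙 (d ≟ w)
        lo hi : ℕ
        lo = 𝟙 (m <? R)
        hi = 𝟙 (m <? suc R)
        #w #other : ℕ
        #w = ∑[ d < Q ] is-w d
        #other = ∑[ d < Q ] (1 ∸ is-w d)
        #w≡1 : #w ≡ 1
        #w≡1 = trans (sum<-cong (λ d → trans (𝟙-cong (d ≟ w) (w ≟ d) sym sym) (sym (*-identityˡ _))) Q)
                     (sum<-select (λ _ → 1) Q w<Q)
        #other≡a : #other ≡ a
        #other≡a = +-cancelˡ-≡ 1 _ _ (begin
          1 + #other                          ≡⟨ cong (_+ #other) #w≡1 ⟨
          #w + #other                         ≡⟨ sum<-+ is-w (λ d → 1 ∸ is-w d) Q ⟨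
          ∑[ d < Q ] (is-w d + (1 ∸ is-w d))  ≡⟨ sum<-cong (λ d → m+[n∸m]≡n (𝟙≤1 (d ≟ w))) Q ⟩
          ∑[ d < Q ] 1                        ≡⟨ trans (sum<-const 1 Q) (*-identityʳ Q) ⟩
          Q                                   ∎)
        split : ∀ d → 𝟙 (is-w d + m <? suc R) ≡ lo * is-w d + hi * (1 ∸ is-w d)
        split d with d ≟ w
        ... | yes _ = trans (𝟙-cong (suc m <? suc R) (m <? R) s<s⁻¹ s<s)
                            (sym (trans (cong₂ _+_ (*-identityʳ lo) (*-zeroʳ hi)) (+-identityʳ lo)))
        ... | no _  = sym (cong₂ _+_ (*-zeroʳ lo) (*-identityʳ hi))

    fewCount-suc : ∀ M R → fewCount (suc M) (suc R) ≡ fewCount M R + a * fewCount M (suc R)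
    fewCount-suc M R = begin
      ∑[ n < Q * Q ^ M ] 𝟙 (digitCount (suc M) n <? suc R)                       ≡⟨ sum<-blocks Q _ (Q ^ M) ⟩
      ∑[ x < Q ^ M ] ∑[ d < Q ] 𝟙 (digitCount (suc M) (Q * x + d) <? suc R)      ≡⟨ sum<-cong (λ x → trans (lowest-digit x) (digit-block (digitCount M x) R)) (Q ^ M) ⟩
      ∑[ x < Q ^ M ] (𝟙 (digitCount M x <? R) + a * 𝟙 (digitCount M x <? suc R)) ≡⟨ sum<-+ _ _ (Q ^ M) ⟩
      fewCount M R + ∑[ x < Q ^ M ] (a * 𝟙 (digitCount M x <? suc R))           ≡⟨ cong (fewCount M R +_) (sum<-*ˡ a _ (Q ^ M)) ⟩
      fewCount M R + a * fewCount M (suc R)                                      ∎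
      where
      open ≡-Reasoning
      lowest-digit : ∀ x → ∑[ d < Q ] 𝟙 (digitCount (suc M) (Q * x + d) <? suc R)
                         ≡ ∑[ d < Q ] 𝟙 (𝟙 (d ≟ w) + digitCount M x <? suc R)
      lowest-digit x = sum<-cong-< Q (λ d d<Q → cong (λ c → 𝟙 (c <? suc R)) (cong₂ _+_
        (𝟙-cong ((Q * x + d) % Q ≟ w) (d ≟ w) (trans (sym ([Q*x+d]%Q≡d x d d<Q))) (trans ([Q*x+d]%Q≡d x d d<Q)))
        (cong (digitCount M) ([Q*x+d]/Q≡x x d d<Q))))

    fewCount-zero : ∀ M → fewCount M 0 ≡ 0
    fewCount-zero M = sum<-≡0 (Q ^ M) (λ _ _ → refl)

    fewCount-≤ : ∀ M R → fewCount M R ≤ Q ^ M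
    fewCount-≤ M R = sum<-≤N (λ n → 𝟙≤1 (digitCount M n <? R)) (Q ^ M)

    fewCount-monoʳ : ∀ M R → fewCount M R ≤ fewCount M (suc R)
    fewCount-monoʳ M R = sum<-mono (λ n → 𝟙-mono (digitCount M n <? R) (digitCount M n <? suc R) m≤n⇒m≤1+n) (Q ^ M)

    fewCount-suc-≤ : ∀ M R → fewCount (suc M) R ≤ Q * fewCount M R
    fewCount-suc-≤ M zero    = ≤-reflexive (trans (fewCount-zero (suc M)) (sym (trans (cong (Q *_) (fewCount-zero M)) (*-zeroʳ Q))))
    fewCount-suc-≤ M (suc R) = begin
      fewCount (suc M) (suc R)               ≡⟨ fewCount-suc M R ⟩
      fewCount M R + a * fewCount M (suc R)  ≤⟨ +-monoˡ-≤ _ (fewCount-monoʳ M R) ⟩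
      Q * fewCount M (suc R)                 ∎
      where open ≤-Reasoning

    fewCount-proportion : ∀ K M R i → K * fewCount M R ≤ Q ^ M → K * fewCount (i + M) R ≤ Q ^ (i + M)
    fewCount-proportion K M R zero    h = h
    fewCount-proportion K M R (suc i) h = begin
      K * fewCount (suc (i + M)) R   ≤⟨ *-monoʳ-≤ K (fewCount-suc-≤ (i + M) R) ⟩
      K * (Q * fewCount (i + M) R)   ≡⟨ *-comm-middle K Q _ ⟩
      Q * (K * fewCount (i + M) R)   ≤⟨ *-monoʳ-≤ Q (fewCount-proportion K M R i h) ⟩
      Q * Q ^ (i + M)                ∎
      where
      open ≤-Reasoning
      *-comm-middle : ∀ K Q F → K * (Q * F) ≡ Q * (K * F)
      *-comm-middle = solve-∀

    private
      -- An integer with fewer than R + 1 copies of w among i + M digits either meets a w among its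
      -- i lowest digits and then has fewer than R among the rest (proportion ≤ 1/2K at each step),
      -- or avoids w in all of them (a^i of the Q^i choices).
      few-after : ∀ K M R → (∀ i → 2 * K * fewCount (i + M) R ≤ Q ^ (i + M)) →
                  ∀ i → 2 * K * fewCount (i + M) (suc R) ≤ Q ^ (i + M) + 2 * K * (a ^ i * Q ^ M)
      few-after K M R h zero = ≤-trans (*-monoʳ-≤ (2 * K) (fewCount-≤ M (suc R)))
        (≤-trans (≤-reflexive (cong (2 * K *_) (sym (*-identityˡ (Q ^ M))))) (m≤n+m _ _))
      few-after K M R h (suc i) = begin
        2 * K * fewCount (suc (i + M)) (suc R)                        ≡⟨ cong (2 * K *_) (fewCount-suc (i + M) R) ⟩
        2 * K * (fewCount (i + M) R + a * fewCount (i + M) (suc R))   ≡⟨ distrib (2 * K) a _ _ ⟩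
        2 * K * fewCount (i + M) R + a * (2 * K * fewCount (i + M) (suc R))
                                                                      ≤⟨ +-mono-≤ (h i) (*-monoʳ-≤ a (few-after K M R h i)) ⟩
        Q ^ (i + M) + a * (Q ^ (i + M) + 2 * K * (a ^ i * Q ^ M))     ≡⟨ collect a (Q ^ (i + M)) (2 * K) (a ^ i) (Q ^ M) ⟩
        Q * Q ^ (i + M) + 2 * K * (a * a ^ i * Q ^ M)                 ∎
        where
        open ≤-Reasoning
        distrib : ∀ k a x y → k * (x + a * y) ≡ k * x + a * (k * y)
        distrib = solve-∀
        collect : ∀ a p k x y → p + a * (p + k * (x * y)) ≡ suc a * p + k * (a * x * y)
        collect = solve-∀

    few-digits-density : ∀ R K → Σ ℕ λ M → K * fewCount M R ≤ Q ^ M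
    few-digits-density zero    K = 0 , ≤-trans (≤-reflexive (trans (cong (K *_) (fewCount-zero 0)) (*-zeroʳ K))) z≤n
    few-digits-density (suc R) K with few-digits-density R (2 * K)
    ... | M , h = j + M , *-cancelˡ-≤ 2 (begin
      2 * (K * fewCount (j + M) (suc R))           ≡⟨ *-assoc 2 K _ ⟨
      2 * K * fewCount (j + M) (suc R)             ≤⟨ few-after K M R (λ i → fewCount-proportion (2 * K) M R i h) j ⟩
      Q ^ (j + M) + 2 * K * (a ^ j * Q ^ M)        ≡⟨ cong (Q ^ (j + M) +_) (*-assoc (2 * K) (a ^ j) (Q ^ M)) ⟨
      Q ^ (j + M) + 2 * K * a ^ j * Q ^ M          ≤⟨ +-monoʳ-≤ (Q ^ (j + M)) (*-monoˡ-≤ (Q ^ M) 2Ka^j≤Q^j) ⟩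
      Q ^ (j + M) + Q ^ j * Q ^ M                  ≡⟨ cong (Q ^ (j + M) +_) (^-distribˡ-+-* Q j M) ⟨
      Q ^ (j + M) + Q ^ (j + M)                    ≡⟨ cong (Q ^ (j + M) +_) (+-identityʳ _) ⟨
      2 * Q ^ (j + M)                              ∎)
      where
      open ≤-Reasoning
      j : ℕ
      j = a * (2 * K)
      2Ka^j≤Q^j : 2 * K * a ^ j ≤ Q ^ j
      2Ka^j≤Q^j = K*a^[aK]≤[1+a]^[aK] a (2 * K) 0<a

    digitCount-periodic : ∀ M n → digitCount M (Q ^ M + n) ≡ digitCount M n
    digitCount-periodic zero    n = refl
    digitCount-periodic (suc M) n = cong₂ _+_
      (𝟙-cong ((Q * Q ^ M + n) % Q ≟ w) (n % Q ≟ w) (trans (sym same-digit)) (trans same-digit))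
      (trans (cong (digitCount M) shifted) (digitCount-periodic M (n / Q)))
      where
      same-digit : (Q * Q ^ M + n) % Q ≡ n % Q
      same-digit = trans (cong (_% Q) (trans (+-comm (Q * Q ^ M) n) (cong (n +_) (*-comm Q (Q ^ M))))) ([m+kn]%n≡m%n n (Q ^ M) Q)
      shifted : (Q * Q ^ M + n) / Q ≡ Q ^ M + n / Q
      shifted = trans (+-distrib-/-∣ˡ n (divides (Q ^ M) (*-comm Q (Q ^ M))))
                      (cong (_+ n / Q) (trans (cong (_/ Q) (*-comm Q (Q ^ M))) (m*n/n≡m (Q ^ M) Q)))

open import Data.Integer as ℤ using (ℤ; +_)
open import Data.Fin using (Fin)
open import Data.List using (List)
open import Data.Product using (∃; Σ; _×_)
open import Relation.Binary.PropositionalEquality using (_≡_; _≢_)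
open import Relation.Nullary using (¬_)
open import Function.Bundles using (_⇔_)

module FactorialRatio (P : List ℤ) {r s t : ℕ} (C : Fin r → ℕ) (D : Fin s → ℕ) (E F : Fin t → ℤ)
  (C-pos : ∀ i → 0 < C i) (D-pos : ∀ j → 0 < D j) (sums-equal : sumFin C ≡ sumFin D)
  (S : ℕ → ℤ) (L≢0 : ∀ n → linProd E F n ≢ + 0) (S-eq : ∀ n → S n ℤ.* denom E F D n ≡ numer P C n) where

  open import Data.Nat
  open import Data.Nat.Properties
  open import Data.Nat.Divisibility
  open import Data.Nat.DivMod
  open import Data.Nat.Primality
  open import Data.Nat.Tactic.RingSolver using (solve-∀)
  open import Data.Fin using (Fin; zero; suc)
  open import Data.Fin.Properties using (any?)
  open import Data.Integer as ℤ using (ℤ; +_; ∣_∣)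
  import Data.Integer.Properties as ℤ
  import Data.Integer.Divisibility.Signed as ℤ
  open import Data.Product using (Σ; ∃; _×_; _,_; proj₁; proj₂)
  open import Data.Sum using (_⊎_; inj₁; inj₂)
  open import Function using (_∘_)
  open import Relation.Binary.PropositionalEquality hiding (J)
  open import Relation.Nullary using (¬_; ¬?; Dec; yes; no; contradiction)
  open import Relation.Nullary.Decidable using (_⊎-dec_; _×-dec_)
  open import Function.Bundles using (_⇔_)
  open FiniteSums
  open PrimeValuation
  open FiniteDifferences
  open FloorArithmetic
  open DigitDensity
  open Density
  open Multiplicities

  ∣S∣ ∣L∣ ∣P∣ ∏C! ∏D! : ℕ → ℕ
  ∣S∣ n = ∣ S n ∣
  ∣L∣ n = ∣ linProd E F n ∣
  ∣P∣ n = ∣ evalPoly P (+ n) ∣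
  ∏C! n = prodFin (λ i → (C i * n) !)
  ∏D! n = prodFin (λ j → (D j * n) !)

  S-identity : ∀ n → ∣S∣ n * ∣L∣ n * ∏D! n ≡ ∣P∣ n * ∏C! n
  S-identity n = begin
    ∣S∣ n * ∣L∣ n * ∏D! n                ≡⟨ *-assoc (∣S∣ n) _ _ ⟩
    ∣S∣ n * (∣L∣ n * ∏D! n)              ≡⟨ cong (λ x → ∣S∣ n * (∣L∣ n * x)) (∣prodFinℤ∣ D!) ⟨
    ∣S∣ n * (∣L∣ n * ∣ prodFinℤ D! ∣)    ≡⟨ cong (∣S∣ n *_) (ℤ.abs-* (linProd E F n) _) ⟨
    ∣S∣ n * ∣ denom E F D n ∣            ≡⟨ ℤ.abs-* (S n) _ ⟨
    ∣ S n ℤ.* denom E F D n ∣            ≡⟨ cong ∣_∣ (S-eq n) ⟩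
    ∣ numer P C n ∣                      ≡⟨ ℤ.abs-* (evalPoly P (+ n)) _ ⟩
    ∣P∣ n * ∣ prodFinℤ C! ∣              ≡⟨ cong (∣P∣ n *_) (∣prodFinℤ∣ C!) ⟩
    ∣P∣ n * ∏C! n                        ∎
    where
    open ≡-Reasoning
    D! : Fin s → ℤ
    D! j = + ((D j * n) !)
    C! : Fin r → ℤ
    C! i = + ((C i * n) !)

  linearFactor : Fin t → ℕ → ℕ
  linearFactor i n = ∣ E i ℤ.* + n ℤ.+ F i ∣

  ∣L∣≡∏linearFactor : ∀ n → ∣L∣ n ≡ prodFin (λ i → linearFactor i n)
  ∣L∣≡∏linearFactor n = ∣prodFinℤ∣ (λ i → E i ℤ.* + n ℤ.+ F i)

  linearFactor≢0 : ∀ i n → linearFactor i n ≢ 0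
  linearFactor≢0 i n = prodFin≢0⇒f≢0 (λ i → linearFactor i n)
    (λ ∏≡0 → L≢0 n (ℤ.∣i∣≡0⇒i≡0 (trans (∣L∣≡∏linearFactor n) ∏≡0))) i

  Cmax : ℕ
  Cmax = sumFin C

  C≤Cmax : ∀ i → C i ≤ Cmax
  C≤Cmax = f≤sumFin C

  D≤Cmax : ∀ j → D j ≤ Cmax
  D≤Cmax j = ≤-trans (f≤sumFin D j) (≤-reflexive (sym sums-equal))

  floorSum : ∀ {k} → (Fin k → ℕ) → (y z : ℕ) .{{_ : NonZero z}} → ℕ
  floorSum G y z = sumFin (λ i → G i * y / z)

  LandauInequality : Set
  LandauInequality = ∀ y z .{{_ : NonZero z}} → y < z → floorSum D y z ≤ floorSum C y z

  module _ {d : ℕ} {c : ℤ} (c≢0 : c ≢ + 0) (escape : WindowsEscapeDivisors d c (λ n → evalPoly P (+ n))) where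

    private
      -- Near n ≈ qy/z for a prime q larger than everything in sight, the valuations of the factorial
      -- products are the floor sums at y/z, while P(n) can be chosen prime to q.
      module AtLargePrime (y z : ℕ) .{{_ : NonZero z}} (y<z : y < z) (q : ℕ) (q-prime : Prime q)
                          (large : suc Cmax * (suc d * z) + ∣ c ∣ < q) where

        open Valuation q q-prime
        open Legendre q q-prime

        X : ℕ
        X = suc d * z

        [1+Cmax]*X<q : suc Cmax * X < q
        [1+Cmax]*X<q = ≤-<-trans (m≤m+n _ ∣ c ∣) large

        X<q : X < q
        X<q = ≤-<-trans (m≤m+n X (Cmax * X)) [1+Cmax]*X<q

        Cmax<q : Cmax < q
        Cmax<q = ≤-<-trans (m≤m*n Cmax X {{m*n≢0 (suc d) z}}) (≤-<-trans (m≤n+m (Cmax * X) X) [1+Cmax]*X<q)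

        q∤c : ¬ + q ℤ.∣ c
        q∤c q∣c = <⇒≱ (≤-<-trans (m≤n+m ∣ c ∣ _) large)
                      (∣⇒≤ {{≢-nonZero (c≢0 ∘ ℤ.∣i∣≡0⇒i≡0)}} (ℤ.∣⇒∣ᵤ q∣c))

        n₀ : ℕ
        n₀ = suc (y * q / z)

        t′ : ℕ
        t′ = proj₁ (escape (+ q) q∤c n₀)

        n : ℕ
        n = n₀ + t′

        t′≤d : t′ ≤ d
        t′≤d = proj₁ (proj₂ (escape (+ q) q∤c n₀))

        q∤P : ¬ q ∣ ∣P∣ n
        q∤P = proj₂ (proj₂ (escape (+ q) q∤c n₀)) ∘ ℤ.∣ᵤ⇒∣

        yq≤nz : y * q ≤ n * z
        yq≤nz = ≤-trans (<⇒≤ (m<[1+m/n]*n (y * q) z)) (*-monoˡ-≤ z (m≤m+n n₀ t′))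

        nz≤yq+X : n * z ≤ y * q + X
        nz≤yq+X = begin
          n * z                             ≡⟨ *-distribʳ-+ z n₀ t′ ⟩
          z + y * q / z * z + t′ * z        ≤⟨ +-mono-≤ (+-monoʳ-≤ z (m/n*n≤m (y * q) z)) (*-monoˡ-≤ z t′≤d) ⟩
          z + y * q + d * z                 ≡⟨ regroup z (y * q) (d * z) ⟩
          y * q + X                         ∎
          where
          open ≤-Reasoning
          regroup : ∀ a b c → a + b + c ≡ b + (a + c)
          regroup = solve-∀

        δ : ℕ
        δ = n * z ∸ y * q

        nz≡yq+δ : n * z ≡ y * q + δ
        nz≡yq+δ = sym (m+[n∸m]≡n yq≤nz)

        n<q : n < q
        n<q = *-cancelʳ-< z n q (begin-strict
          n * z          ≤⟨ nz≤yq+X ⟩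
          y * q + X      <⟨ +-monoʳ-< (y * q) X<q ⟩
          y * q + q      ≡⟨ +-comm (y * q) q ⟩
          suc y * q      ≤⟨ *-monoˡ-≤ q y<z ⟩
          z * q          ≡⟨ *-comm z q ⟩
          q * z          ∎)
          where open ≤-Reasoning

        valuation-∏! : ∀ {k} (G : Fin k → ℕ) → (∀ i → G i ≤ Cmax) →
                       HasValuation (prodFin (λ i → (G i * n) !)) (floorSum G y z)
        valuation-∏! G G≤Cmax = subst (HasValuation _) (sumFin-cong same-floor)
          (valuation-prodFin _ _ (λ i → legendre-small (G i * n) (*-mono-< (≤-<-trans (G≤Cmax i) Cmax<q) n<q)))
          where
          δ≤X : δ ≤ X
          δ≤X = +-cancelˡ-≤ (y * q) δ X (subst (_≤ y * q + X) nz≡yq+δ nz≤yq+X)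
          same-floor : ∀ i → G i * n / q ≡ G i * y / z
          same-floor i = floor-*-approx (G i) y z n q δ nz≡yq+δ
            (≤-<-trans (*-mono-≤ (G≤Cmax i) δ≤X) (≤-<-trans (m≤n+m (Cmax * X) X) [1+Cmax]*X<q))

        floorSum-≤ : floorSum D y z ≤ floorSum C y z
        floorSum-≤ = ∣⇒≤valuation (valuation-* (valuation-unit q∤P) (valuation-∏! C C≤Cmax))
          (subst (q ^ floorSum D y z ∣_) (S-identity n) (∣n⇒∣m*n (∣S∣ n * ∣L∣ n) (q^v∣x (valuation-∏! D D≤Cmax))))

    landau-inequality : LandauInequality
    landau-inequality y z y<z with prime-above (suc Cmax * (suc d * z) + ∣ c ∣)
    ... | q , q-prime , large = AtLargePrime.floorSum-≤ y z y<z q q-prime large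

  K₀ : ℕ
  K₀ = suc Cmax

  floorSum-1-1 : ∀ {k} (G : Fin k → ℕ) → floorSum G 1 1 ≡ sumFin G
  floorSum-1-1 G = sumFin-cong (λ i → trans (n/1≡n (G i * 1)) (*-identityʳ (G i)))

  floorSum+divisorCount : ∀ {k} (G : Fin k → ℕ) → (∀ i → 0 < G i) → (∀ i → G i ≤ Cmax) →
    ∀ c .{{_ : NonZero c}} → floorSum G K₀ (suc (c * K₀)) + divisorCount c G ≡ floorSum G 1 c
  floorSum+divisorCount G G-pos G≤Cmax c = begin
    floorSum G K₀ (suc (c * K₀)) + divisorCount c G                  ≡⟨ sumFin-+ (λ i → G i * K₀ / suc (c * K₀)) _ ⟨
    sumFin (λ i → G i * K₀ / suc (c * K₀) + 𝟙 (c ∣? G i))            ≡⟨ sumFin-cong jump ⟩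
    floorSum G 1 c                                                   ∎
    where
    open ≡-Reasoning
    jump : ∀ i → G i * K₀ / suc (c * K₀) + 𝟙 (c ∣? G i) ≡ G i * 1 / c
    jump i = trans (floor-divisibility-jump (G i) c K₀ (G-pos i) (s≤s (G≤Cmax i))) (cong (_/ c) (sym (*-identityʳ (G i))))

  divisorCount-large : ∀ {k} (G : Fin k → ℕ) → (∀ i → 0 < G i) → (∀ i → G i ≤ Cmax) →
                       ∀ c → Cmax < c → divisorCount c G ≡ 0
  divisorCount-large {k} G G-pos G≤Cmax c Cmax<c = begin
    divisorCount c G       ≡⟨ sumFin-cong (λ i → 𝟙-no (c ∣? G i) (c∤G i)) ⟩
    sumFin {k} (λ _ → 0)   ≡⟨ sumFin-const {k} 0 ⟩
    k * 0                  ≡⟨ *-zeroʳ k ⟩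
    0                      ∎
    where
    open ≡-Reasoning
    c∤G : ∀ i → ¬ c ∣ G i
    c∤G i c∣G = <⇒≱ (≤-<-trans (G≤Cmax i) Cmax<c) (∣⇒≤ {{>-nonZero (G-pos i)}} c∣G)

  StrictPoint : Set
  StrictPoint = Σ ℕ λ y → Σ ℕ λ z → y < suc z × floorSum D y (suc z) < floorSum C y (suc z)

  module _ (landau : LandauInequality) (values-differ : ¬ (∀ x → (∃ λ i → C i ≡ x) ⇔ (∃ λ j → D j ≡ x))) where

    private
      Candidate : ℕ → Set
      Candidate c′ = floorSum D 1 (suc c′) < floorSum C 1 (suc c′) ⊎
                     floorSum D K₀ (suc (suc c′ * K₀)) < floorSum C K₀ (suc (suc c′ * K₀))

      candidate? : ∀ c′ → Dec (Candidate c′)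
      candidate? c′ = (floorSum D 1 (suc c′) <? floorSum C 1 (suc c′)) ⊎-dec
                      (floorSum D K₀ (suc (suc c′ * K₀)) <? floorSum C K₀ (suc (suc c′ * K₀)))

      not-strict⇒equal : ∀ y z .{{_ : NonZero z}} → y < z → ¬ floorSum D y z < floorSum C y z →
                         floorSum C y z ≡ floorSum D y z
      not-strict⇒equal y z y<z ¬strict = ≤-antisym (≮⇒≥ ¬strict) (landau y z y<z)

      -- The floor sums at 1/c and K₀/(1 + cK₀) determine how many C i and D j are divisible by c.
      no-candidate⇒same-divisor-counts : ¬ (∃ λ c′ → c′ < K₀ × Candidate c′) →
                                          ∀ c → 0 < c → divisorCount c C ≡ divisorCount c D
      no-candidate⇒same-divisor-counts none (suc c′) _ with c′ <? K₀
      ... | no  c′≮K₀ = trans (divisorCount-large C C-pos C≤Cmax (suc c′) large)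
                              (sym (divisorCount-large D D-pos D≤Cmax (suc c′) large))
        where
        large : Cmax < suc c′
        large = s≤s (≤-trans (n≤1+n Cmax) (≮⇒≥ c′≮K₀))
      ... | yes c′<K₀ = +-cancelˡ-≡ _ _ _ (begin
        floorSum C K₀ (suc (suc c′ * K₀)) + divisorCount (suc c′) C  ≡⟨ floorSum+divisorCount C C-pos C≤Cmax (suc c′) ⟩
        floorSum C 1 (suc c′)                                        ≡⟨ at-1/c c′ c′<K₀ ⟩
        floorSum D 1 (suc c′)                                        ≡⟨ floorSum+divisorCount D D-pos D≤Cmax (suc c′) ⟨
        floorSum D K₀ (suc (suc c′ * K₀)) + divisorCount (suc c′) D  ≡⟨ cong (_+ _) at-K₀ ⟨
        floorSum C K₀ (suc (suc c′ * K₀)) + divisorCount (suc c′) D  ∎)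
        where
        open ≡-Reasoning
        at-K₀ : floorSum C K₀ (suc (suc c′ * K₀)) ≡ floorSum D K₀ (suc (suc c′ * K₀))
        at-K₀ = not-strict⇒equal K₀ _ (s<s (m≤m+n K₀ _)) (λ strict → none (c′ , c′<K₀ , inj₂ strict))
        at-1/c : ∀ c′ → c′ < K₀ → floorSum C 1 (suc c′) ≡ floorSum D 1 (suc c′)
        at-1/c zero     _     = trans (floorSum-1-1 C) (trans sums-equal (sym (floorSum-1-1 D)))
        at-1/c (suc c″) c′<K₀ = not-strict⇒equal 1 (suc (suc c″)) (s<s z<s) (λ strict → none (suc c″ , c′<K₀ , inj₁ strict))

    strict-point : StrictPoint
    strict-point with anyUpTo? candidate? K₀
    ... | yes (zero   , _ , inj₁ strict) = contradiction strict (<-irrefl at-1/1)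
      where
      at-1/1 : floorSum D 1 1 ≡ floorSum C 1 1
      at-1/1 = trans (floorSum-1-1 D) (trans (sym sums-equal) (sym (floorSum-1-1 C)))
    ... | yes (suc c′ , _ , inj₁ strict) = 1 , suc c′ , s<s z<s , strict
    ... | yes (c′     , _ , inj₂ strict) = K₀ , suc c′ * K₀ , s<s (m≤m+n K₀ _) , strict
    ... | no  none = contradiction (same-divisor-counts⇒same-values C D C-pos D-pos (no-candidate⇒same-divisor-counts none))
                                   values-differ

  module AtPrime (landau : LandauInequality) (q : ℕ) (q-prime : Prime q) (y₀ z₀′ : ℕ) (y₀<z₀ : y₀ < suc z₀′)
                 (strict₀ : floorSum D y₀ (suc z₀′) < floorSum C y₀ (suc z₀′)) where

    open Valuation q q-prime
    open Legendre q q-prime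

    -- b is large enough that q^b > 2K₀z₀ bounds the approximation errors in good-level-approx.
    z₀ b : ℕ
    z₀ = suc z₀′
    b = 2 * K₀ * z₀

    a Q : ℕ
    a = pred (q ^ b)
    Q = suc a

    q^b≡Q : q ^ b ≡ Q
    q^b≡Q = sym (suc-pred (q ^ b) {{m^n≢0 q b}})

    b<Q : b < Q
    b<Q = subst (b <_) q^b≡Q (n<q^n b)

    z₀≤b : z₀ ≤ b
    z₀≤b = m≤n*m z₀ (2 * K₀)

    0<a : 0 < a
    0<a = ≤-pred (<-≤-trans (s<s (s<s z≤n)) (<-≤-trans (s<s (≤-trans (s≤s z≤n) z₀≤b)) b<Q))

    -- w/Q is the least fraction with denominator Q strictly above y₀/z₀.
    w : ℕ
    w = suc (y₀ * Q / z₀)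

    y₀Q<wz₀ : y₀ * Q < w * z₀
    y₀Q<wz₀ = m<[1+m/n]*n (y₀ * Q) z₀

    wz₀≤y₀Q+z₀ : w * z₀ ≤ y₀ * Q + z₀
    wz₀≤y₀Q+z₀ = subst (_≤ y₀ * Q + z₀) (+-comm (y₀ * Q / z₀ * z₀) z₀) (+-monoˡ-≤ z₀ (m/n*n≤m (y₀ * Q) z₀))

    w<Q : w < Q
    w<Q = *-cancelʳ-< z₀ w Q (begin-strict
      w * z₀          ≤⟨ wz₀≤y₀Q+z₀ ⟩
      y₀ * Q + z₀     <⟨ +-monoʳ-< (y₀ * Q) (≤-<-trans z₀≤b b<Q) ⟩
      y₀ * Q + Q      ≡⟨ +-comm (y₀ * Q) Q ⟩
      suc y₀ * Q      ≤⟨ *-monoˡ-≤ Q y₀<z₀ ⟩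
      z₀ * Q          ≡⟨ *-comm z₀ Q ⟩
      Q * z₀          ∎)
      where open ≤-Reasoning

    ε : ℕ
    ε = w * z₀ ∸ y₀ * Q

    wz₀≡y₀Q+ε : w * z₀ ≡ y₀ * Q + ε
    wz₀≡y₀Q+ε = sym (m+[n∸m]≡n (<⇒≤ y₀Q<wz₀))

    ε≤z₀ : ε ≤ z₀
    ε≤z₀ = +-cancelˡ-≤ (y₀ * Q) ε z₀ (subst (_≤ y₀ * Q + z₀) wz₀≡y₀Q+ε wz₀≤y₀Q+z₀)

    open Digits a 0<a w w<Q hiding (Q)

    q^[j+b]≡q^j*Q : ∀ j → q ^ (j + b) ≡ q ^ j * Q
    q^[j+b]≡q^j*Q j = trans (^-distribˡ-+-* q j b) (cong (q ^ j *_) q^b≡Q)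

    digit-window : ∀ n j → (n /q^ j) % Q ≡ w → n %q^ (j + b) ≡ w * q ^ j + n %q^ j
    digit-window n j digit≡w = begin-equality
      n %q^ (j + b)                              ≡⟨ %-congʳ {{m^n≢0 q (j + b)}} (q^[j+b]≡q^j*Q j) ⟩
      n % (q ^ j * Q)                            ≡⟨ cong (_% (q ^ j * Q)) n≡ ⟩
      (w * q ^ j + ρ + m / Q * (q ^ j * Q)) % (q ^ j * Q)
                                                 ≡⟨ [m+kn]%n≡m%n (w * q ^ j + ρ) (m / Q) (q ^ j * Q) ⟩
      (w * q ^ j + ρ) % (q ^ j * Q)              ≡⟨ m<n⇒m%n≡m low<q^j*Q ⟩
      w * q ^ j + ρ                              ∎
      where
      open ≤-Reasoning
      instance
        q^j≢0 : NonZero (q ^ j)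
        q^j≢0 = m^n≢0 q j
        q^j*Q≢0 : NonZero (q ^ j * Q)
        q^j*Q≢0 = m*n≢0 (q ^ j) Q
      m ρ : ℕ
      m = n /q^ j
      ρ = n %q^ j
      n≡ : n ≡ w * q ^ j + ρ + m / Q * (q ^ j * Q)
      n≡ = begin-equality
        n                                ≡⟨ m≡m%n+[m/n]*n n (q ^ j) ⟩
        ρ + m * q ^ j                    ≡⟨ cong (λ x → ρ + x * q ^ j) (m≡m%n+[m/n]*n m Q) ⟩
        ρ + (m % Q + m / Q * Q) * q ^ j  ≡⟨ cong (λ x → ρ + (x + m / Q * Q) * q ^ j) digit≡w ⟩
        ρ + (w + m / Q * Q) * q ^ j      ≡⟨ regroup ρ w (m / Q) Q (q ^ j) ⟩
        w * q ^ j + ρ + m / Q * (q ^ j * Q) ∎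
        where
        regroup : ∀ ρ w x Q p → ρ + (w + x * Q) * p ≡ w * p + ρ + x * (p * Q)
        regroup = solve-∀
      low<q^j*Q : w * q ^ j + ρ < q ^ j * Q
      low<q^j*Q = begin-strict
        w * q ^ j + ρ        <⟨ +-monoʳ-< (w * q ^ j) (m%n<n n (q ^ j)) ⟩
        w * q ^ j + q ^ j    ≡⟨ +-comm (w * q ^ j) (q ^ j) ⟩
        suc w * q ^ j        ≤⟨ *-monoˡ-≤ (q ^ j) w<Q ⟩
        Q * q ^ j            ≡⟨ *-comm Q (q ^ j) ⟩
        q ^ j * Q            ∎

    Good : ℕ → ℕ → Set
    Good ℓ n = b ≤ ℓ × (n /q^ (ℓ ∸ b)) % Q ≡ w

    Good? : ∀ ℓ n → Dec (Good ℓ n)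
    Good? ℓ n = (b ≤? ℓ) ×-dec ((n /q^ (ℓ ∸ b)) % Q ≟ w)

    floorSumAt : ∀ {k} → (Fin k → ℕ) → ℕ → ℕ → ℕ
    floorSumAt G y ℓ = floorSum G y (q ^ ℓ) {{m^n≢0 q ℓ}}

    -- At a good level ℓ, n mod qˡ lies just above y₀/z₀ · qˡ, so the floor sums there are those at y₀/z₀.
    good-level-approx : ∀ ℓ n → Good ℓ n →
      Σ ℕ λ δ → n %q^ ℓ * z₀ ≡ y₀ * q ^ ℓ + δ × (∀ {x} → x ≤ Cmax → x * δ < q ^ ℓ)
    good-level-approx ℓ n (b≤ℓ , digit≡w) = ε * q ^ j + ρ * z₀ , approx , small
      where
      open ≤-Reasoning
      j ρ : ℕ
      j = ℓ ∸ b
      ρ = n %q^ j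
      q^ℓ≡q^j*Q : q ^ ℓ ≡ q ^ j * Q
      q^ℓ≡q^j*Q = trans (cong (q ^_) (sym (m∸n+n≡m b≤ℓ))) (q^[j+b]≡q^j*Q j)
      n%q^ℓ≡wq^j+ρ : n %q^ ℓ ≡ w * q ^ j + ρ
      n%q^ℓ≡wq^j+ρ = trans (cong (n %q^_) (sym (m∸n+n≡m b≤ℓ))) (digit-window n j digit≡w)
      expand : ∀ w p ρ z → (w * p + ρ) * z ≡ w * z * p + ρ * z
      expand = solve-∀
      collect : ∀ y Q e p x → (y * Q + e) * p + x ≡ y * (p * Q) + (e * p + x)
      collect = solve-∀
      approx : n %q^ ℓ * z₀ ≡ y₀ * q ^ ℓ + (ε * q ^ j + ρ * z₀)
      approx = begin-equality
        n %q^ ℓ * z₀                    ≡⟨ cong (_* z₀) n%q^ℓ≡wq^j+ρ ⟩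
        (w * q ^ j + ρ) * z₀            ≡⟨ expand w (q ^ j) ρ z₀ ⟩
        w * z₀ * q ^ j + ρ * z₀         ≡⟨ cong (λ x → x * q ^ j + ρ * z₀) wz₀≡y₀Q+ε ⟩
        (y₀ * Q + ε) * q ^ j + ρ * z₀   ≡⟨ collect y₀ Q ε (q ^ j) (ρ * z₀) ⟩
        y₀ * (q ^ j * Q) + (ε * q ^ j + ρ * z₀) ≡⟨ cong (λ x → y₀ * x + (ε * q ^ j + ρ * z₀)) q^ℓ≡q^j*Q ⟨
        y₀ * q ^ ℓ + (ε * q ^ j + ρ * z₀)       ∎
      double : ∀ z p → z * p + p * z ≡ 2 * z * p
      double = solve-∀
      δ≤2z₀q^j : ε * q ^ j + ρ * z₀ ≤ 2 * z₀ * q ^ j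
      δ≤2z₀q^j = ≤-trans (+-mono-≤ (*-monoˡ-≤ (q ^ j) ε≤z₀) (*-monoˡ-≤ z₀ (<⇒≤ (m%n<n n (q ^ j) {{m^n≢0 q j}}))))
                         (≤-reflexive (double z₀ (q ^ j)))
      regroup : ∀ K z p → K * (2 * z * p) ≡ 2 * K * z * p
      regroup = solve-∀
      small : ∀ {x} → x ≤ Cmax → x * (ε * q ^ j + ρ * z₀) < q ^ ℓ
      small {x} x≤Cmax = begin-strict
        x * (ε * q ^ j + ρ * z₀)       ≤⟨ *-mono-≤ x≤Cmax δ≤2z₀q^j ⟩
        Cmax * (2 * z₀ * q ^ j)        <⟨ +-monoˡ-< _ (≤-trans (m^n>0 q j) (m≤n*m (q ^ j) (2 * z₀))) ⟩
        K₀ * (2 * z₀ * q ^ j)          ≡⟨ regroup K₀ z₀ (q ^ j) ⟩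
        b * q ^ j                      ≤⟨ *-monoˡ-≤ (q ^ j) (<⇒≤ b<Q) ⟩
        Q * q ^ j                      ≡⟨ trans (*-comm Q (q ^ j)) (sym q^ℓ≡q^j*Q) ⟩
        q ^ ℓ                          ∎

    good-level-strict : ∀ ℓ n → Good ℓ n → floorSumAt D (n %q^ ℓ) ℓ < floorSumAt C (n %q^ ℓ) ℓ
    good-level-strict ℓ n good = subst₂ _<_ (sym (same-floors D D≤Cmax)) (sym (same-floors C C≤Cmax)) strict₀
      where
      open Σ (good-level-approx ℓ n good) renaming (proj₁ to δ; proj₂ to approx)
      same-floors : ∀ {k} (G : Fin k → ℕ) → (∀ i → G i ≤ Cmax) → floorSumAt G (n %q^ ℓ) ℓ ≡ floorSum G y₀ z₀
      same-floors G G≤Cmax = sumFin-cong (λ i →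
        floor-*-approx (G i) y₀ z₀ (n %q^ ℓ) (q ^ ℓ) δ {{_}} {{m^n≢0 q ℓ}} (proj₁ approx) (proj₂ approx (G≤Cmax i)))

    floorSumAt-mod : ∀ {k} (G : Fin k → ℕ) ℓ n → floorSumAt G n ℓ ≡ n /q^ ℓ * sumFin G + floorSumAt G (n %q^ ℓ) ℓ
    floorSumAt-mod G ℓ n = begin
      sumFin (λ i → G i * n / q ^ ℓ)                            ≡⟨ sumFin-cong shift ⟩
      sumFin (λ i → G i * (n /q^ ℓ) + G i * (n %q^ ℓ) / q ^ ℓ)  ≡⟨ sumFin-+ (λ i → G i * (n /q^ ℓ)) _ ⟩
      sumFin (λ i → G i * (n /q^ ℓ)) + floorSumAt G (n %q^ ℓ) ℓ ≡⟨ cong (_+ floorSumAt G (n %q^ ℓ) ℓ) whole-part ⟩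
      n /q^ ℓ * sumFin G + floorSumAt G (n %q^ ℓ) ℓ             ∎
      where
      open ≡-Reasoning
      instance
        q^ℓ≢0 : NonZero (q ^ ℓ)
        q^ℓ≢0 = m^n≢0 q ℓ
      n≡ : n ≡ n /q^ ℓ * q ^ ℓ + n %q^ ℓ
      n≡ = trans (m≡m%n+[m/n]*n n (q ^ ℓ)) (+-comm (n %q^ ℓ) _)
      shift : ∀ i → G i * n / q ^ ℓ ≡ G i * (n /q^ ℓ) + G i * (n %q^ ℓ) / q ^ ℓ
      shift i = trans (cong (λ x → G i * x / q ^ ℓ) n≡) (floor-*-shift (G i) (n /q^ ℓ) (n %q^ ℓ) (q ^ ℓ))
      whole-part : sumFin (λ i → G i * (n /q^ ℓ)) ≡ n /q^ ℓ * sumFin G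
      whole-part = trans (sumFin-cong (λ i → *-comm (G i) (n /q^ ℓ))) (sumFin-*ˡ (n /q^ ℓ) G)

    level-bound : ∀ ℓ n → floorSumAt D n ℓ + 𝟙 (Good? ℓ n) ≤ floorSumAt C n ℓ
    level-bound ℓ n = begin
      floorSumAt D n ℓ + 𝟙 (Good? ℓ n)                                     ≡⟨ cong (_+ 𝟙 (Good? ℓ n)) (floorSumAt-mod D ℓ n) ⟩
      n /q^ ℓ * sumFin D + floorSumAt D (n %q^ ℓ) ℓ + 𝟙 (Good? ℓ n)       ≡⟨ +-assoc (n /q^ ℓ * sumFin D) _ _ ⟩
      n /q^ ℓ * sumFin D + (floorSumAt D (n %q^ ℓ) ℓ + 𝟙 (Good? ℓ n))     ≤⟨ +-mono-≤ (≤-reflexive (cong (n /q^ ℓ *_) (sym sums-equal))) remainder ⟩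
      n /q^ ℓ * sumFin C + floorSumAt C (n %q^ ℓ) ℓ                        ≡⟨ floorSumAt-mod C ℓ n ⟨
      floorSumAt C n ℓ                                                     ∎
      where
      open ≤-Reasoning
      remainder : floorSumAt D (n %q^ ℓ) ℓ + 𝟙 (Good? ℓ n) ≤ floorSumAt C (n %q^ ℓ) ℓ
      remainder with Good? ℓ n
      ... | yes good = subst (_≤ floorSumAt C (n %q^ ℓ) ℓ) (+-comm 1 _) (good-level-strict ℓ n good)
      ... | no  _    = subst (_≤ floorSumAt C (n %q^ ℓ) ℓ) (sym (+-identityʳ _))
                               (landau (n %q^ ℓ) (q ^ ℓ) {{m^n≢0 q ℓ}} (m%n<n n (q ^ ℓ) {{m^n≢0 q ℓ}}))

    levels-bound : ∀ K n → sumFin (λ j → ν K (D j * n)) + ∑[ l < K ] 𝟙 (Good? (suc l) n) ≤ sumFin (λ i → ν K (C i * n))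
    levels-bound K n = begin
      sumFin (λ j → ν K (D j * n)) + #good             ≡⟨ cong (_+ #good) (sum<-sumFin (λ j l → D j * n /q^ suc l) K) ⟨
      ∑[ l < K ] floorSumAt D n (suc l) + #good        ≡⟨ sum<-+ (λ l → floorSumAt D n (suc l)) good K ⟨
      ∑[ l < K ] (floorSumAt D n (suc l) + good l)     ≤⟨ sum<-mono (λ l → level-bound (suc l) n) K ⟩
      ∑[ l < K ] floorSumAt C n (suc l)                ≡⟨ sum<-sumFin (λ i l → C i * n /q^ suc l) K ⟩
      sumFin (λ i → ν K (C i * n))                     ∎
      where
      open ≤-Reasoning
      good : ℕ → ℕ
      good l = 𝟙 (Good? (suc l) n)
      #good : ℕ
      #good = sum< good K

    -- The M lowest base-Q digits of n /q^ j that equal w sit at the good levels j + b, j + 2b, …, j + Mb.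
    digits≤good-levels : ∀ M j n → digitCount M (n /q^ j) ≤ ∑[ l < b * M ] 𝟙 (Good? (j + suc l) n)
    digits≤good-levels zero    j n = z≤n
    digits≤good-levels (suc M) j n = begin
      𝟙 ((n /q^ j) % Q ≟ w) + digitCount M ((n /q^ j) / Q)                    ≡⟨ cong₂ _+_ lowest-digit (cong (digitCount M) higher-digits) ⟩
      𝟙 (Good? (j + b) n) + digitCount M (n /q^ (j + b))                       ≤⟨ +-mono-≤ last-level (digits≤good-levels M (j + b) n) ⟩
      ∑[ l < b ] 𝟙 (Good? (j + suc l) n) + ∑[ l < b * M ] 𝟙 (Good? (j + b + suc l) n)
                                                                              ≡⟨ cong (_+_ (∑[ l < b ] 𝟙 (Good? (j + suc l) n))) (sum<-cong reindex (b * M)) ⟩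
      ∑[ l < b ] 𝟙 (Good? (j + suc l) n) + ∑[ l < b * M ] 𝟙 (Good? (j + suc (b + l)) n)
                                                                              ≡⟨ sum<-++ (λ l → 𝟙 (Good? (j + suc l) n)) b (b * M) ⟨
      ∑[ l < b + b * M ] 𝟙 (Good? (j + suc l) n)                               ≡⟨ cong (sum< (λ l → 𝟙 (Good? (j + suc l) n))) (*-suc b M) ⟨
      ∑[ l < b * suc M ] 𝟙 (Good? (j + suc l) n)                               ∎
      where
      open ≤-Reasoning
      lowest-digit : 𝟙 ((n /q^ j) % Q ≟ w) ≡ 𝟙 (Good? (j + b) n)
      lowest-digit = 𝟙-cong ((n /q^ j) % Q ≟ w) (Good? (j + b) n)
        (λ digit≡w → m≤n+m b j , trans (cong (λ x → (n /q^ x) % Q) (m+n∸n≡m j b)) digit≡w)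
        (λ (_ , digit≡w) → trans (cong (λ x → (n /q^ x) % Q) (sym (m+n∸n≡m j b))) digit≡w)
      higher-digits : (n /q^ j) / Q ≡ n /q^ (j + b)
      higher-digits = trans (m/n/o≡m/[n*o] n (q ^ j) Q {{m^n≢0 q j}} {{_}} {{m*n≢0 (q ^ j) Q {{m^n≢0 q j}}}})
                            (/-congʳ {{m*n≢0 (q ^ j) Q {{m^n≢0 q j}}}} {{m^n≢0 q (j + b)}} (sym (q^[j+b]≡q^j*Q j)))
      last-level : 𝟙 (Good? (j + b) n) ≤ ∑[ l < b ] 𝟙 (Good? (j + suc l) n)
      last-level = subst (λ x → 𝟙 (Good? (j + x) n) ≤ ∑[ l < b ] 𝟙 (Good? (j + suc l) n)) (suc-pred b)
                         (term≤sum< (λ l → 𝟙 (Good? (j + suc l) n)) b (subst (pred b <_) (suc-pred b) (n<1+n (pred b))))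
      reindex : ∀ l → 𝟙 (Good? (j + b + suc l) n) ≡ 𝟙 (Good? (j + suc (b + l)) n)
      reindex l = cong (λ x → 𝟙 (Good? x n)) (trans (+-assoc j b (suc l)) (cong (λ x → j + x) (+-suc b l)))

    digits-bound : ∀ K M n → b * M ≤ K →
      sumFin (λ j → ν K (D j * n)) + digitCount M n ≤ sumFin (λ i → ν K (C i * n))
    digits-bound K M n bM≤K = begin
      sumFin (λ j → ν K (D j * n)) + digitCount M n                      ≤⟨ +-monoʳ-≤ _ digits≤good ⟩
      sumFin (λ j → ν K (D j * n)) + ∑[ l < b * M ] 𝟙 (Good? (suc l) n) ≤⟨ +-monoʳ-≤ _ (sum<-monoʳ (λ l → 𝟙 (Good? (suc l) n)) bM≤K) ⟩
      sumFin (λ j → ν K (D j * n)) + ∑[ l < K ] 𝟙 (Good? (suc l) n)     ≤⟨ levels-bound K n ⟩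
      sumFin (λ i → ν K (C i * n))                                       ∎
      where
      open ≤-Reasoning
      digits≤good : digitCount M n ≤ ∑[ l < b * M ] 𝟙 (Good? (suc l) n)
      digits≤good = subst (λ x → digitCount M x ≤ ∑[ l < b * M ] 𝟙 (Good? (suc l) n)) (n/1≡n n) (digits≤good-levels M 0 n)

    q^e∣∣S∣ : ∀ e M (J : Fin t → ℕ) n → e + sumFin J ≤ digitCount M n → (∀ i → ¬ q ^ J i ∣ linearFactor i n) →
              q ^ e ∣ ∣S∣ n
    q^e∣∣S∣ e M J n many-digits q^J∤L = q^[e+a]∣x*s⇒q^a∣s e (valuation-* val-L val-D!) q^[v+β+e]∣LD!S
      where
      K : ℕ
      K = b * M + K₀ * n
      G*n<q^K : ∀ {k} (G : Fin k → ℕ) → (∀ i → G i ≤ Cmax) → ∀ i → G i * n < q ^ K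
      G*n<q^K G G≤Cmax i = ≤-<-trans (≤-trans (*-monoˡ-≤ n (≤-trans (G≤Cmax i) (n≤1+n Cmax))) (m≤n+m (K₀ * n) (b * M))) (n<q^n K)
      α β : ℕ
      α = sumFin (λ i → ν K (C i * n))
      β = sumFin (λ j → ν K (D j * n))
      val-C! : HasValuation (∏C! n) α
      val-C! = valuation-prodFin _ _ (λ i → legendre K (C i * n) (G*n<q^K C C≤Cmax i))
      val-D! : HasValuation (∏D! n) β
      val-D! = valuation-prodFin _ _ (λ j → legendre K (D j * n) (G*n<q^K D D≤Cmax j))
      open Σ (valuation-prodFin-bounded (λ i → linearFactor i n) J (λ i → linearFactor≢0 i n) q^J∤L)
        renaming (proj₁ to v; proj₂ to bounded-L)
      val-L : HasValuation (∣L∣ n) v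
      val-L = subst (λ x → HasValuation x v) (sym (∣L∣≡∏linearFactor n)) (proj₁ bounded-L)
      v+β+e≤α : v + β + e ≤ α
      v+β+e≤α = begin
        v + β + e              ≡⟨ regroup v β e ⟩
        β + (e + v)            ≤⟨ +-monoʳ-≤ β (+-monoʳ-≤ e (proj₂ bounded-L)) ⟩
        β + (e + sumFin J)     ≤⟨ +-monoʳ-≤ β many-digits ⟩
        β + digitCount M n     ≤⟨ digits-bound K M n (m≤m+n (b * M) (K₀ * n)) ⟩
        α                      ∎
        where
        open ≤-Reasoning
        regroup : ∀ v β e → v + β + e ≡ β + (e + v)
        regroup = solve-∀
      rotate : ∀ x y z → x * y * z ≡ y * z * x
      rotate = solve-∀
      q^[v+β+e]∣LD!S : q ^ (v + β + e) ∣ ∣L∣ n * ∏D! n * ∣S∣ n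
      q^[v+β+e]∣LD!S = ∣-trans (q^-∣-mono v+β+e≤α) (subst (q ^ α ∣_)
        (trans (sym (S-identity n)) (rotate (∣S∣ n) (∣L∣ n) (∏D! n))) (∣n⇒∣m*n (∣P∣ n) (q^v∣x val-C!)))

    linear-separated : ∀ i W → Σ ℕ λ J → Separated (q ^ W) (λ n → q ^ J ∣ linearFactor i n)
    linear-separated i W with E i ℤ.≟ + 0
    ... | yes E≡0 = ∣ F i ∣ , λ {n} _ q^J∣L _ → contradiction q^J∣L (never n)
      where
      never : ∀ n → ¬ q ^ ∣ F i ∣ ∣ linearFactor i n
      never n q^J∣L = <⇒≱ (n<q^n ∣ F i ∣)
                          (subst (q ^ ∣ F i ∣ ≤_) L≡∣F∣ (∣⇒≤ {{≢-nonZero (linearFactor≢0 i n)}} q^J∣L))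
        where
        L≡∣F∣ : linearFactor i n ≡ ∣ F i ∣
        L≡∣F∣ = cong ∣_∣ (trans (cong (λ x → x ℤ.* + n ℤ.+ F i) E≡0) (ℤ.+-identityˡ (F i)))
    ... | no  E≢0 with valuation-exists ∣ E i ∣ (E≢0 ∘ ℤ.∣i∣≡0⇒i≡0)
    ...   | e , val-E = e + W , separated
      where
      -- q^(e+W) divides E·(n′ − n), the difference of the two linear factors.
      separated : Separated (q ^ W) (λ n → q ^ (e + W) ∣ linearFactor i n)
      separated {n} {n′} n<n′ q^J∣Ln q^J∣Ln′ =
        subst (q ^ W + n ≤_) (m∸n+n≡m (<⇒≤ n<n′)) (+-monoˡ-≤ n (∣⇒≤ {{>-nonZero (m<n⇒0<n∸m n<n′)}} q^W∣n′-n))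
        where
        difference : (E i ℤ.* + n′ ℤ.+ F i) ℤ.- (E i ℤ.* + n ℤ.+ F i) ≡ E i ℤ.* + (n′ ∸ n)
        difference = trans (cancel (E i) (+ n′) (+ n) (F i)) (cong (E i ℤ.*_) (trans (ℤ.m-n≡m⊖n n′ n) (ℤ.⊖-≥ (<⇒≤ n<n′))))
          where
          open import Data.Integer.Tactic.RingSolver as ℤ-Solver using ()
          cancel : ∀ e x y f → (e ℤ.* x ℤ.+ f) ℤ.- (e ℤ.* y ℤ.+ f) ≡ e ℤ.* (x ℤ.- y)
          cancel = ℤ-Solver.solve-∀
        q^J∣E[n′-n] : q ^ (e + W) ∣ ∣ E i ∣ * (n′ ∸ n)
        q^J∣E[n′-n] = subst (q ^ (e + W) ∣_) (trans (cong ∣_∣ difference) (ℤ.abs-* (E i) (+ (n′ ∸ n))))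
          (ℤ.∣⇒∣ᵤ (ℤ.∣m∣n⇒∣m-n (ℤ.∣ᵤ⇒∣ {+ (q ^ (e + W))} {E i ℤ.* + n′ ℤ.+ F i} q^J∣Ln′)
                                (ℤ.∣ᵤ⇒∣ {+ (q ^ (e + W))} {E i ℤ.* + n ℤ.+ F i} q^J∣Ln)))
        q^W∣n′-n : q ^ W ∣ n′ ∸ n
        q^W∣n′-n = q^[e+a]∣x*s⇒q^a∣s W val-E q^J∣E[n′-n]

    nondivisible≤ : ∀ e M (J : Fin t → ℕ) n →
      𝟙 (¬? (q ^ e ∣? ∣S∣ n)) ≤ 𝟙 (digitCount M n <? e + sumFin J) + sumFin (λ i → 𝟙 (q ^ J i ∣? linearFactor i n))
    nondivisible≤ e M J n with digitCount M n <? e + sumFin J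
    ... | yes _ = ≤-trans (𝟙≤1 (¬? (q ^ e ∣? ∣S∣ n))) (m≤m+n 1 _)
    ... | no few with any? (λ i → q ^ J i ∣? linearFactor i n)
    ...   | yes (i , q^J∣L) = ≤-trans (𝟙≤1 (¬? (q ^ e ∣? ∣S∣ n)))
                                      (≤-trans (≤-reflexive (sym (𝟙-yes (q ^ J i ∣? linearFactor i n) q^J∣L)))
                                               (f≤sumFin (λ i → 𝟙 (q ^ J i ∣? linearFactor i n)) i))
    ...   | no  none = ≤-trans (≤-reflexive (𝟙-no (¬? (q ^ e ∣? ∣S∣ n)) (λ ¬q^e∣S → ¬q^e∣S q^e∣S))) z≤n
      where
      q^e∣S : q ^ e ∣ ∣S∣ n
      q^e∣S = q^e∣∣S∣ e M J n (≮⇒≥ few) (λ i q^J∣L → none (i , q^J∣L))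

    prime-power-densityZero : ∀ e → DensityZero (λ n → 𝟙 (¬? (q ^ e ∣? ∣S∣ n)))
    prime-power-densityZero e k = sparse-mono (nondivisible≤ e M J) (sparse-+ k digits-sparse factors-sparse)
      where
      W : ℕ
      W = 2 * (2 ^ t * (2 * k))
      J : Fin t → ℕ
      J i = proj₁ (linear-separated i W)
      R : ℕ
      R = e + sumFin J
      few-digits : Σ ℕ λ M → 2 * (2 * k) * fewCount M R ≤ Q ^ M
      few-digits = few-digits-density R (2 * (2 * k))
      M : ℕ
      M = proj₁ few-digits
      digits-sparse : Sparse (2 * k) (λ n → 𝟙 (digitCount M n <? R))
      digits-sparse = sparse-periodic (2 * k) _ (Q ^ M) {{m^n≢0 Q M}}
        (λ n → cong (λ x → 𝟙 (x <? R)) (digitCount-periodic M n)) (proj₂ few-digits)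
      factors-sparse : Sparse (2 * k) (λ n → sumFin (λ i → 𝟙 (q ^ J i ∣? linearFactor i n)))
      factors-sparse = sparse-sumFin (2 * k) (λ i n → 𝟙 (q ^ J i ∣? linearFactor i n)) (λ i →
        sparse-separated (2 ^ t * (2 * k)) (q ^ W) {{m^n≢0 q W}} (λ n → q ^ J i ∣? linearFactor i n)
                         (<⇒≤ (n<q^n W)) (proj₂ (linear-separated i W)))

  nondivisible-densityZero : LandauInequality → StrictPoint → ∀ m → 0 < m → DensityZero (λ n → 𝟙 (¬? (m ∣? ∣S∣ n)))
  nondivisible-densityZero landau (y₀ , z₀′ , y₀<z₀ , strict₀) = prime-power-induction _ unit coprime-factor
    where
    unit : DensityZero (λ n → 𝟙 (¬? (1 ∣? ∣S∣ n)))
    unit k = sparse-≡0 k (λ n → 𝟙-no (¬? (1 ∣? ∣S∣ n)) (λ 1∤S → 1∤S (1∣ ∣S∣ n)))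
    coprime-factor : ∀ q e m → Prime q → ¬ q ∣ m → DensityZero (λ n → 𝟙 (¬? (m ∣? ∣S∣ n))) →
                     DensityZero (λ n → 𝟙 (¬? (q ^ suc e * m ∣? ∣S∣ n)))
    coprime-factor q e m q-prime q∤m m-rare k =
      sparse-mono split (sparse-+ k (prime-power-densityZero (suc e) (2 * k)) (m-rare (2 * k)))
      where
      open AtPrime landau q q-prime y₀ z₀′ y₀<z₀ strict₀ using (prime-power-densityZero)
      open Valuation q q-prime using (q^a∣x∧m∣x⇒q^a*m∣x)
      split : ∀ n → 𝟙 (¬? (q ^ suc e * m ∣? ∣S∣ n)) ≤ 𝟙 (¬? (q ^ suc e ∣? ∣S∣ n)) + 𝟙 (¬? (m ∣? ∣S∣ n))
      split n with q ^ suc e ∣? ∣S∣ n | m ∣? ∣S∣ n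
      ... | no _      | _       = ≤-trans (𝟙≤1 (¬? (q ^ suc e * m ∣? ∣S∣ n))) (m≤m+n 1 _)
      ... | yes _     | no _    = 𝟙≤1 (¬? (q ^ suc e * m ∣? ∣S∣ n))
      ... | yes q^e∣S | yes m∣S =
        ≤-reflexive (𝟙-no (¬? (q ^ suc e * m ∣? ∣S∣ n)) (λ ¬∣ → ¬∣ (q^a∣x∧m∣x⇒q^a*m∣x (suc e) q∤m q^e∣S m∣S)))

  ℤ-nondivisible≤ : ∀ m n → 𝟙 (¬? (+ m ℤ.∣? S n)) ≤ 𝟙 (¬? (m ∣? ∣S∣ n))
  ℤ-nondivisible≤ m n = 𝟙-mono (¬? (+ m ℤ.∣? S n)) (¬? (m ∣? ∣S∣ n)) (λ m∤S m∣S → m∤S (ℤ.∣ᵤ⇒∣ m∣S))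

  S≡0 : (∀ n → evalPoly P (+ n) ≡ + 0) → ∀ n → S n ≡ + 0
  S≡0 P≡0 n with ℤ.i*j≡0⇒i≡0∨j≡0 (S n) (trans (S-eq n) (trans (cong (ℤ._* ∏C!ℤ) (P≡0 n)) (ℤ.*-zeroˡ ∏C!ℤ)))
    where
    ∏C!ℤ : ℤ
    ∏C!ℤ = prodFinℤ (λ i → + ((C i * n) !))
  ... | inj₁ S≡0 = S≡0
  ... | inj₂ denom≡0 with ℤ.i*j≡0⇒i≡0∨j≡0 (linProd E F n) denom≡0
  ...   | inj₁ L≡0  = contradiction L≡0 (L≢0 n)
  ...   | inj₂ ∏≡0 = contradiction (trans (sym (∣prodFinℤ∣ (λ j → + ((D j * n) !)))) (cong ∣_∣ ∏≡0))
                                   (prodFin≢0 _ (λ j → ≢-nonZero⁻¹ _ {{(D j * n) !≢0}}))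

open import Data.Nat.Properties using (≤-trans; *-monoʳ-≤; m+n∸m≡n; ≤-reflexive)
open import Data.Nat.Divisibility using (_∣0)
open import Data.Product using (_,_)
open import Data.Sum using (inj₁; inj₂)
import Data.Integer.Divisibility.Signed as ℤ
open import Relation.Binary.PropositionalEquality using (sym; trans; cong; subst)
open import Relation.Nullary using (¬?)
open FiniteSums
open Density
open FiniteDifferences

complement-countDiv≤ : ∀ m S N → N ∸ countDiv m S N ≤ ∑[ n < N ] 𝟙 (¬? (+ m ℤ.∣? S n))
complement-countDiv≤ m S N = ≤-reflexive (trans
  (cong (_∸ countDiv m S N) (sym (length-filter+rejected (λ n → + m ℤ.∣? S n) (λ n → n) N)))
  (m+n∸m≡n (countDiv m S N) _))

corollary1 : (p : ℕ) → Prime p → (P : List ℤ) →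
    (r s t : ℕ) (C : Fin r → ℕ) (D : Fin s → ℕ) (E F : Fin t → ℤ) →
    (∀ i → 0 < C i) → (∀ i → 0 < D i) →
    sumFin C ≡ sumFin D →
    ¬ (∀ x → (∃ λ i → C i ≡ x) ⇔ (∃ λ j → D j ≡ x)) →
    (S : ℕ → ℤ) →
    (∀ n → linProd E F n ≢ + 0) →
    (∀ n → S n ℤ.* denom E F D n ≡ numer P C n) →
    (m : ℕ) → 0 < m →
    (k : ℕ) → 0 < k →
    Σ ℕ λ N₀ → ∀ N → N₀ ≤ N → k ℕ.* (N ∸ countDiv m S N) ≤ N
corollary1 _ _ P r s t C D E F C-pos D-pos sums-equal values-differ S L≢0 S-eq m 0<m k _ =
  threshold , λ N N₀≤N → ≤-trans (*-monoʳ-≤ k (complement-countDiv≤ m S N)) (bound N N₀≤N)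
  where
  open FactorialRatio P C D E F C-pos D-pos sums-equal S L≢0 S-eq
  nondivisible-rare : DensityZero (λ n → 𝟙 (¬? (+ m ℤ.∣? S n)))
  nondivisible-rare with polynomial-zero-or-escapes P
  ... | inj₁ P≡0 = λ k′ → sparse-≡0 k′ (λ n → 𝟙-no (¬? (+ m ℤ.∣? S n)) (λ m∤S → m∤S (m∣S n)))
    where
    m∣S : ∀ n → + m ℤ.∣ S n
    m∣S n = subst (+ m ℤ.∣_) (sym (S≡0 P≡0 n)) (ℤ.∣ᵤ⇒∣ (m ∣0))
  ... | inj₂ (_ , _ , c≢0 , escape) = λ k′ →
    sparse-mono (ℤ-nondivisible≤ m) (nondivisible-densityZero landau (strict-point landau values-differ) m 0<m k′)
    where
    landau : LandauInequality
    landau = landau-inequality c≢0 escape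
  open Sparse (nondivisible-rare k)
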